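{- Let $H\in\mathcal G$ be such that every element $h\in H$, written as $h=\varepsilon_Aq$ with $A\in RM(2,4)$ and $q\in Q$, has either $A\in RM(1,4)$ or $A$ of defect $2$, and suppose $|x_0H|=64$. Let $C=\Omega\setminus B_0$ (the affine hyperplane containing $\omega_1$ but not $\omega_0$) and $H^{**}=H\langle\varepsilon_C\rangle$. Then: (i) the spherical code obtained by scaling the elements of $x_0H^{**}$ to unit length has 128 elements and cosine set $\{ -\tfrac14,0,\tfrac14\}$; (ii) the spherical code in $\mathbb{R}^{15}$ obtained by projecting $x_0H^{**}$ orthogonally onto $v_{\omega_0}^\perp$ and rescaling to unit length has 128 elements and cosine set $\{ -\tfrac13,-\tfrac1{15},\tfrac15\}$.
   Context: A spherical code is a finite set of unit vectors; its cosines are the inner products of distinct members. Let $\Omega=\mathbb{F}_2^4$, $V=\mathbb{R}^{16}$ with orthonormal basis $(v_\omega)_{\omega\in\Omega}$, $x_0=\sum_\omega v_\omega$. For $A\subseteq\Omega$, $\varepsilon_A$ is the orthogonal map negating $v_\omega$ for $\omega\in A$ and fixing the others. Subsets of $\Omega$ are binary words (addition = symmetric difference); $RM(1,4)\subset RM(2,4)$ are the Reed–Muller codes on $\Omega$, $RM(r,4)$ spanned by affine subspaces of codimension $r$. Defect of $A\in RM(2,4)$: $A$ is the support of a Boolean function $F$ of degree $\le2$; the alternating form $B_F(u,w)=F(x+u+w)+F(x+u)+F(x+w)+F(x)$ has rank $2k$, and $k$ is the defect. Let $\omega_0=0$, fix $\omega_1\ne0$ and a linear hyperplane $B_0$ with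 $\omega_1\notin B_0$. Let $Q=\{g\in GL(4,2):\omega_1g=\omega_1, B_0g=B_0\}\cong GL(3,2)$ acting by permutation matrices $v_\omega\mapsto v_{\omega g}$. Let $E=\{\varepsilon_A:A\in RM(1,4),\ \omega_0,\omega_1\notin A\}$, $J=\{\varepsilon_A:A\in RM(2,4),\ \omega_0,\omega_1\notin A\}$, and let $\mathcal G$ be the set of subgroups $H$ with $E\le H\le JQ$ and $H/E\cong GL(3,2)$. -}

module Defs where

open import Data.Bool using (Bool; true; false; _∧_; _xor_; not; if_then_else_)
open import Data.Nat as ℕ using (ℕ; zero; suc; _∸_; _^_)
open import Data.Integer as ℤ using (ℤ; +_; -_)
open import Data.Fin as Fin using (Fin)
open import Data.Vec as Vec using (Vec; []; _∷_; lookup; tabulate; zipWith; foldr; replicate; map)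
open import Data.Vec.Properties using (≡-dec)
open import Data.List as List using (List; length; filter; deduplicate; allFin)
open import Data.List.Membership.Propositional using (_∈_)
open import Data.List.Relation.Unary.All using (All)
open import Data.Rational as ℚ using (ℚ; 0ℚ; _/_)
open import Data.Product using (Σ; ∃; _×_; _,_)
open import Data.Sum using (_⊎_)
open import Relation.Nullary using (¬_)
open import Relation.Nullary.Decidable using (⌊_⌋)
open import Relation.Nullary.Decidable using (T?)
open import Relation.Binary.PropositionalEquality using (_≡_; _≢_)

-- Ω = F₂⁴, encoded as Fin 16 (binary expansion, most significant bit first)

F2⁴ : Set
F2⁴ = Vec Bool 4

Ω : Set
Ω = Fin 16

bitsTable : Vec F2⁴ 16
bitsTable =
  (false ∷ false ∷ false ∷ false ∷ []) ∷ (false ∷ false ∷ false ∷ true ∷ []) ∷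
  (false ∷ false ∷ true ∷ false ∷ []) ∷ (false ∷ false ∷ true ∷ true ∷ []) ∷
  (false ∷ true ∷ false ∷ false ∷ []) ∷ (false ∷ true ∷ false ∷ true ∷ []) ∷
  (false ∷ true ∷ true ∷ false ∷ []) ∷ (false ∷ true ∷ true ∷ true ∷ []) ∷
  (true ∷ false ∷ false ∷ false ∷ []) ∷ (true ∷ false ∷ false ∷ true ∷ []) ∷
  (true ∷ false ∷ true ∷ false ∷ []) ∷ (true ∷ false ∷ true ∷ true ∷ []) ∷
  (true ∷ true ∷ false ∷ false ∷ []) ∷ (true ∷ true ∷ false ∷ true ∷ []) ∷
  (true ∷ true ∷ true ∷ false ∷ []) ∷ (true ∷ true ∷ true ∷ true ∷ []) ∷ []

bits : Ω → F2⁴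
bits ω = lookup bitsTable ω

b2n : Bool → ℕ
b2n false = 0
b2n true  = 1

fromBits : F2⁴ → Ω
fromBits (a ∷ b ∷ c ∷ d ∷ []) =
  Fin.fromℕ< {8 ℕ.* b2n a ℕ.+ 4 ℕ.* b2n b ℕ.+ 2 ℕ.* b2n c ℕ.+ b2n d} (lemma a b c d)
  where
  open import Data.Nat using (_<_; s≤s; z≤n)
  lemma : ∀ a b c d → 8 ℕ.* b2n a ℕ.+ 4 ℕ.* b2n b ℕ.+ 2 ℕ.* b2n c ℕ.+ b2n d < 16
  lemma false false false false = s≤s z≤n
  lemma false false false true  = s≤s (s≤s z≤n)
  lemma false false true  false = s≤s (s≤s (s≤s z≤n))
  lemma false false true  true  = s≤s (s≤s (s≤s (s≤s z≤n)))
  lemma false true  false false = s≤s (s≤s (s≤s (s≤s (s≤s z≤n))))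
  lemma false true  false true  = s≤s (s≤s (s≤s (s≤s (s≤s (s≤s z≤n)))))
  lemma false true  true  false = s≤s (s≤s (s≤s (s≤s (s≤s (s≤s (s≤s z≤n))))))
  lemma false true  true  true  = s≤s (s≤s (s≤s (s≤s (s≤s (s≤s (s≤s (s≤s z≤n)))))))
  lemma true  false false false = s≤s (s≤s (s≤s (s≤s (s≤s (s≤s (s≤s (s≤s (s≤s z≤n))))))))
  lemma true  false false true  = s≤s (s≤s (s≤s (s≤s (s≤s (s≤s (s≤s (s≤s (s≤s (s≤s z≤n)))))))))
  lemma true  false true  false = s≤s (s≤s (s≤s (s≤s (s≤s (s≤s (s≤s (s≤s (s≤s (s≤s (s≤s z≤n))))))))))
  lemma true  false true  true  = s≤s (s≤s (s≤s (s≤s (s≤s (s≤s (s≤s (s≤s (s≤s (s≤s (s≤s (s≤s z≤n)))))))))))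
  lemma true  true  false false = s≤s (s≤s (s≤s (s≤s (s≤s (s≤s (s≤s (s≤s (s≤s (s≤s (s≤s (s≤s (s≤s z≤n))))))))))))
  lemma true  true  false true  = s≤s (s≤s (s≤s (s≤s (s≤s (s≤s (s≤s (s≤s (s≤s (s≤s (s≤s (s≤s (s≤s (s≤s z≤n)))))))))))))
  lemma true  true  true  false = s≤s (s≤s (s≤s (s≤s (s≤s (s≤s (s≤s (s≤s (s≤s (s≤s (s≤s (s≤s (s≤s (s≤s (s≤s z≤n))))))))))))))
  lemma true  true  true  true  = s≤s (s≤s (s≤s (s≤s (s≤s (s≤s (s≤s (s≤s (s≤s (s≤s (s≤s (s≤s (s≤s (s≤s (s≤s (s≤s z≤n)))))))))))))))

zero⁴ : F2⁴
zero⁴ = replicate 4 false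

dot : ∀ {n} → Vec Bool n → Vec Bool n → Bool
dot u v = foldr _ _xor_ false (zipWith _∧_ u v)

_⊕_ : Ω → Ω → Ω
ω ⊕ η = fromBits (zipWith _xor_ (bits ω) (bits η))

ω₀ : Ω
ω₀ = fromBits zero⁴

Mat₂ : ℕ → Set
Mat₂ n = Vec (Vec Bool n) n

col : ∀ {m n} → Vec (Vec Bool n) m → Fin n → Vec Bool m
col M j = map (λ r → lookup r j) M

_·₂_ : ∀ {n} → Vec Bool n → Mat₂ n → Vec Bool n
v ·₂ M = tabulate (λ j → dot v (col M j))

_*₂_ : ∀ {n} → Mat₂ n → Mat₂ n → Mat₂ n
M *₂ N = map (λ r → r ·₂ N) M

I₂ : ∀ n → Mat₂ n
I₂ n = tabulate (λ i → tabulate (λ j → ⌊ i Fin.≟ j ⌋))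

InGL : ∀ n → Mat₂ n → Set
InGL n M = Σ (Mat₂ n) (λ N → M *₂ N ≡ I₂ n)

_▹_ : Ω → Mat₂ 4 → Ω
ω ▹ g = fromBits (bits ω ·₂ g)

Sub : Set
Sub = Vec Bool 16

∅ : Sub
∅ = replicate 16 false

_+ₛ_ : Sub → Sub → Sub
A +ₛ B = zipWith _xor_ A B

_∈ₛ_ : Ω → Sub → Set
ω ∈ₛ A = lookup A ω ≡ true

_∉ₛ_ : Ω → Sub → Set
ω ∉ₛ A = lookup A ω ≡ false

LinIndep : ∀ {r} → Vec F2⁴ r → Set
LinIndep {r} ls = (s : Vec Bool r) →
  foldr _ (zipWith _xor_) zero⁴ (zipWith (λ c l → map (c ∧_) l) s ls) ≡ zero⁴ →
  s ≡ replicate r false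

AffSub : ℕ → Sub → Set
AffSub r A = Σ (Vec F2⁴ r) λ ls → Σ (Vec Bool r) λ cs → LinIndep ls ×
  (A ≡ tabulate (λ ω → foldr _ _∧_ true
          (zipWith (λ l c → not (dot l (bits ω) xor c)) ls cs)))

RM : ℕ → Sub → Set
RM r A = Σ (List Sub) λ gens → All (AffSub r) gens × (A ≡ List.foldr _+ₛ_ ∅ gens)

-- the alternating form B_F of F = indicator of A (evaluated at x = ω₀ = 0)
BF : Sub → Ω → Ω → Bool
BF A u w = lookup A (ω₀ ⊕ (u ⊕ w)) xor lookup A (ω₀ ⊕ u) xor lookup A (ω₀ ⊕ w) xor lookup A ω₀

inRad : Sub → Ω → Bool
inRad A u = List.foldr (λ w r → not (BF A u w) ∧ r) true (allFin 16)

-- rank(B_F) = 4 - dim(radical); rank = 2k  ⇔  |radical| = 2^(4 - 2k)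
HasDefect : Sub → ℕ → Set
HasDefect A k = RM 2 A × (2 ℕ.* k ℕ.≤ 4) ×
  (length (filter (λ u → T? (inRad A u)) (allFin 16)) ≡ 2 ^ (4 ∸ 2 ℕ.* k))

-- V = ℝ¹⁶ (integer points suffice: all matrices involved are integral)

Mat : ℕ → Set
Mat n = Vec (Vec ℤ n) n

sumℤ : ∀ {n} → Vec ℤ n → ℤ
sumℤ = foldr _ ℤ._+_ (+ 0)

ip : ∀ {n} → Vec ℤ n → Vec ℤ n → ℤ
ip x y = sumℤ (zipWith ℤ._*_ x y)

colℤ : ∀ {m n} → Vec (Vec ℤ n) m → Fin n → Vec ℤ m
colℤ M j = map (λ r → lookup r j) M

-- row vector times matrix (maps act on the right: x ↦ x g)
_⋆_ : ∀ {n} → Vec ℤ n → Mat n → Vec ℤ n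
x ⋆ M = tabulate (λ j → ip x (colℤ M j))

_*ₘ_ : ∀ {n} → Mat n → Mat n → Mat n
M *ₘ N = map (λ r → r ⋆ N) M

Iₘ : ∀ n → Mat n
Iₘ n = tabulate (λ i → tabulate (λ j → if ⌊ i Fin.≟ j ⌋ then + 1 else + 0))

x₀ : Vec ℤ 16
x₀ = replicate 16 (+ 1)

εM : Sub → Mat 16
εM A = tabulate (λ i → tabulate (λ j →
  if ⌊ i Fin.≟ j ⌋ then (if lookup A i then - (+ 1) else + 1) else + 0))

PM : Mat₂ 4 → Mat 16
PM g = tabulate (λ i → tabulate (λ j → if ⌊ j Fin.≟ (i ▹ g) ⌋ then + 1 else + 0))

B₀ : F2⁴ → Sub
B₀ b = tabulate (λ ω → not (dot b (bits ω)))

Cset : F2⁴ → Sub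
Cset b = tabulate (λ ω → dot b (bits ω))

InQ : Ω → F2⁴ → Mat₂ 4 → Set
InQ ω₁ b g = InGL 4 g × (ω₁ ▹ g ≡ ω₁) ×
  ((∀ ω → ω ∈ₛ B₀ b → (ω ▹ g) ∈ₛ B₀ b) ×
   (∀ η → η ∈ₛ B₀ b → Σ Ω λ ω → ω ∈ₛ B₀ b × ω ▹ g ≡ η))

InE : Ω → Mat 16 → Set
InE ω₁ h = Σ Sub λ A → RM 1 A × ω₀ ∉ₛ A × ω₁ ∉ₛ A × h ≡ εM A

InJQ : Ω → F2⁴ → Mat 16 → Set
InJQ ω₁ b h = Σ Sub λ A → Σ (Mat₂ 4) λ g →
  RM 2 A × ω₀ ∉ₛ A × ω₁ ∉ₛ A × InQ ω₁ b g × h ≡ εM A *ₘ PM g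

IsSubgroup : List (Mat 16) → Set
IsSubgroup H = (Iₘ 16 ∈ H) ×
  (∀ h k → h ∈ H → k ∈ H → (h *ₘ k) ∈ H) ×
  (∀ h → h ∈ H → Σ (Mat 16) λ k → k ∈ H × h *ₘ k ≡ Iₘ 16)

-- H/E ≅ GL(3,2): a surjective homomorphism H → GL(3,2) with kernel exactly E
QuotIsGL32 : Ω → List (Mat 16) → Set
QuotIsGL32 ω₁ H = Σ (Mat 16 → Mat₂ 3) λ φ →
  (∀ h → h ∈ H → InGL 3 (φ h)) ×
  (∀ h k → h ∈ H → k ∈ H → φ (h *ₘ k) ≡ φ h *₂ φ k) ×
  (∀ g → InGL 3 g → Σ (Mat 16) λ h → h ∈ H × φ h ≡ g) ×
  (∀ h → h ∈ H → (φ h ≡ I₂ 3 → InE ω₁ h) × (InE ω₁ h → φ h ≡ I₂ 3))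

In𝒢 : Ω → F2⁴ → List (Mat 16) → Set
In𝒢 ω₁ b H = IsSubgroup H × (∀ h → InE ω₁ h → h ∈ H) ×
  (∀ h → h ∈ H → InJQ ω₁ b h) × QuotIsGL32 ω₁ H

card : ∀ {n} → List (Vec ℤ n) → ℕ
card xs = length (deduplicate (≡-dec ℤ._≟_) xs)

-- Spherical codes obtained by normalising nonzero integer vectors.
-- x/|x| = y/|y|  iff x, y are positively proportional.

SameRay : ∀ {n} → Vec ℤ n → Vec ℤ n → Set
SameRay x y = Σ ℕ λ a → Σ ℕ λ b →
  map (ℤ._*_ (+ suc a)) x ≡ map (ℤ._*_ (+ suc b)) y

toℚ : ℤ → ℚ
toℚ z = z / 1

-- c is the cosine ⟨x,y⟩/(|x||y|) of the unit vectors x/|x|, y/|y|: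
-- c² |x|²|y|² = ⟨x,y⟩²  and  c has the sign of ⟨x,y⟩
IsCos : ∀ {n} → Vec ℤ n → Vec ℤ n → ℚ → Set
IsCos x y c = (c ℚ.* c ℚ.* toℚ (ip x x ℤ.* ip y y) ≡ toℚ (ip x y ℤ.* ip x y)) ×
  (0ℚ ℚ.≤ c ℚ.* toℚ (ip x y))

-- "the spherical code obtained by scaling the vectors of xs to unit length
--  has m elements and cosine set cs"
record CodeIs {n : ℕ} (xs : List (Vec ℤ n)) (m : ℕ) (cs : List ℚ) : Set where
  field
    nonzero     : ∀ x → x ∈ xs → ¬ (x ≡ replicate n (+ 0))
    pt          : Fin m → Vec ℤ n
    pt∈         : ∀ i → pt i ∈ xs
    ptDistinct  : ∀ i j → i ≢ j → ¬ SameRay (pt i) (pt j)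
    covers      : ∀ x → x ∈ xs → Σ (Fin m) λ i → SameRay x (pt i)
    cosIn       : ∀ i j → i ≢ j → Σ ℚ λ c → c ∈ cs × IsCos (pt i) (pt j) c
    cosAttained : ∀ c → c ∈ cs → Σ (Fin m) λ i → Σ (Fin m) λ j → i ≢ j × IsCos (pt i) (pt j) c

-- Every h ∈ H is a signed permutation ε_A P_g, so x₀h is a ±1-vector and H acts
-- orthogonally: ⟨x₀h, x₀k⟩ = ⟨x₀m, x₀⟩ and ⟨x₀hε_C, x₀k⟩ = ⟨x₀mε_C, x₀⟩ with m = hk⁻¹ = ε_D P_r.
-- These are the character sum Σ(-1)^D and the Walsh coefficient of D at the functional
-- defining C. D avoids ω₀ and ω₁ and is affine or bent, and a finite computation shows
-- that such sums lie in {16, 4, 0, -4}, resp. {4, 0, -4}. Hence the 128 vectors x₀H ∪ x₀Hε_C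
-- have norm 16 and mutual inner products in {-4, 0, 4}; deleting the coordinate ω₀, where
-- all of them equal 1, leaves norm 15 and inner products in {-5, -1, 3}. The value 0 is
-- ⟨x₀, x₀ε_C⟩; the values ±4 come from pairing a bent element of H (one exists, since
-- affine elements give at most 16 orbit points) with the points x₀ε_{C_ℓ} of x₀E ∪ x₀Eε_C.

module Submission where

open import Defs
open import Data.Bool using (true)
open import Data.Nat using (ℕ)
open import Data.Integer using (+_)
open import Data.Rational using (ℚ; 0ℚ; _/_; -_)
open import Data.Vec using (removeAt)
open import Data.List using (List; []; _∷_; _++_; map)
open import Data.List.Membership.Propositional using (_∈_)
open import Data.Product using (Σ; _×_)
open import Data.Sum using (_⊎_)
open import Relation.Binary.PropositionalEquality using (_≡_)

open import Algebra.Bundles using (CommutativeSemiring; CommutativeRing; CommutativeMonoid; AbelianGroup)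
open import Data.Bool as Bool using (Bool; false; _xor_; _∧_; _∨_; not; if_then_else_)
open import Data.Bool.Properties using (xor-∧-commutativeRing; xor-identityʳ; not-distribʳ-xor; ∧-identityʳ; not-injective)
import Data.Nat as ℕ
import Data.Nat.Properties as ℕ
open import Data.Integer as ℤ using (ℤ; -[1+_]; -<+; -≤+)
import Data.Integer.Properties as ℤ
open import Data.Integer.Tactic.RingSolver using (solve-∀)
import Data.Rational as ℚ
import Data.Rational.Properties as ℚ
open import Data.Fin as Fin using (Fin; zero; suc; punchOut; _↑ˡ_; _↑ʳ_; splitAt)
open import Data.Fin.Properties using (all?; any?; punchOut-injective; injective⇒≤; suc-injective; cast-involutive; splitAt-↑ˡ; splitAt-↑ʳ; join-splitAt)
open import Data.Fin.Permutation using (Permutation′; permutation; _⟨$⟩ˡ_; inverseʳ)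
open import Data.Vec as Vec using (Vec; []; _∷_; lookup; tabulate; zipWith; foldr; replicate)
open import Data.Vec.Properties using (lookup-map; lookup∘tabulate; lookup-zipWith; lookup-replicate; tabulate∘lookup; tabulate-cong; ≡-dec)
open import Data.Vec.Relation.Unary.All as Vec-All using ([]; _∷_)
open import Data.Vec.Relation.Unary.All.Properties using (lookup⁺; lookup⁻)
import Data.List as List
open import Data.List.Properties using (map-∘)
open import Data.List.Membership.Propositional using (_∉_)
open import Data.List.Membership.Propositional.Properties using (∈-map⁺; ∈-map⁻; ∈-++⁺ˡ; ∈-++⁺ʳ; ∈-++⁻; ∈-allFin; ∈-lookup; ∈-deduplicate⁻; ∈-deduplicate⁺)
open import Data.List.Membership.DecPropositional ℤ._≟_ using (_∈?_)
open import Data.List.Relation.Unary.Any as Any using (here; there)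
open import Data.List.Relation.Unary.Any.Properties using (lookup-index)
open import Data.List.Relation.Unary.All as All using (All; []; _∷_)
open import Data.List.Relation.Unary.AllPairs using ([]; _∷_)
open import Data.List.Relation.Unary.Unique.Propositional using (Unique)
open import Data.List.Relation.Unary.Unique.DecPropositional.Properties using (deduplicate-!)
open import Data.List.Relation.Binary.Pointwise using (Pointwise; []; _∷_)
import Data.List.Relation.Binary.Pointwise.Properties as Pointwise
open import Data.Product using (∃; ∃₂; _,_; proj₁; proj₂)
open import Data.Sum as Sum using (inj₁; inj₂; [_,_]′)
open import Function using (_∘_)
open import Relation.Binary.Definitions using (DecidableEquality)
open import Relation.Binary.PropositionalEquality using (_≢_; refl; sym; trans; cong; cong₂; subst; module ≡-Reasoning)
open import Relation.Nullary using (Dec; yes; no; map′; _×-dec_; _⊎-dec_; _→-dec_; contradiction)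
open import Relation.Nullary.Decidable using (⌊_⌋; isYes≗does; dec-true; dec-false; from-yes; from-no; T?)
open import Algebra.Properties.Group (AbelianGroup.group ℤ.+-0-abelianGroup) using (∙-cancelˡ)
open import Algebra.Properties.CommutativeSemigroup
  (CommutativeMonoid.commutativeSemigroup (CommutativeRing.+-commutativeMonoid xor-∧-commutativeRing))
  using (interchange)

-- Linear algebra over a commutative semiring

vec-ext : ∀ {a} {A : Set a} {n} {u v : Vec A n} → (∀ i → lookup u i ≡ lookup v i) → u ≡ v
vec-ext {u = u} {v} eq = trans (sym (tabulate∘lookup u)) (trans (tabulate-cong eq) (tabulate∘lookup v))

module LinearAlgebra {c ℓ} (R : CommutativeSemiring c ℓ) where
  open CommutativeSemiring R hiding (zero) renaming (refl to ≈-refl; sym to ≈-sym; trans to ≈-trans)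
  open import Algebra.Properties.Semiring.Sum semiring public
  open import Relation.Binary.Reasoning.Setoid setoid

  Matrix : ℕ → Set c
  Matrix n = Vec (Vec Carrier n) n

  entry : ∀ {n} → Matrix n → Fin n → Fin n → Carrier
  entry M i j = lookup (lookup M i) j

  inner : ∀ {n} → Vec Carrier n → Vec Carrier n → Carrier
  inner u v = foldr _ _+_ 0# (zipWith _*_ u v)

  column : ∀ {m n} → Vec (Vec Carrier n) m → Fin n → Vec Carrier m
  column M j = Vec.map (λ r → lookup r j) M

  infixl 7 _·_ _∙_
  infixr 7 _▸_

  _·_ : ∀ {n} → Vec Carrier n → Matrix n → Vec Carrier n
  v · M = tabulate (λ j → inner v (column M j))

  _∙_ : ∀ {n} → Matrix n → Matrix n → Matrix n
  M ∙ N = Vec.map (λ r → r · N) M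

  _▸_ : ∀ {m n} → Vec (Vec Carrier n) m → Vec Carrier n → Vec Carrier m
  M ▸ u = Vec.map (λ r → inner r u) M

  inner≈∑ : ∀ {n} (u v : Vec Carrier n) → inner u v ≈ ∑[ i < n ] (lookup u i * lookup v i)
  inner≈∑ []      []      = ≈-refl
  inner≈∑ (x ∷ u) (y ∷ v) = +-congˡ (inner≈∑ u v)

  lookup-· : ∀ {n} v (M : Matrix n) j → lookup (v · M) j ≈ ∑[ i < n ] (lookup v i * entry M i j)
  lookup-· v M j = begin
    lookup (v · M) j                                 ≡⟨ lookup∘tabulate _ j ⟩
    inner v (column M j)                               ≈⟨ inner≈∑ v (column M j) ⟩
    ∑[ i < _ ] (lookup v i * lookup (column M j) i)  ≡⟨ sum-cong-≗ (λ i → cong (lookup v i *_) (lookup-map i _ M)) ⟩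
    ∑[ i < _ ] (lookup v i * entry M i j)            ∎

  entry-∙ : ∀ {n} (M N : Matrix n) i j → entry (M ∙ N) i j ≈ ∑[ k < n ] (entry M i k * entry N k j)
  entry-∙ M N i j = begin
    entry (M ∙ N) i j         ≡⟨ cong (λ r → lookup r j) (lookup-map i _ M) ⟩
    lookup (lookup M i · N) j ≈⟨ lookup-· (lookup M i) N j ⟩
    ∑[ k < _ ] (entry M i k * entry N k j) ∎

  ·-∙ : ∀ {n} v (M N : Matrix n) j → lookup ((v · M) · N) j ≈ lookup (v · (M ∙ N)) j
  ·-∙ {n} v M N j = begin
    lookup ((v · M) · N) j                                           ≈⟨ lookup-· (v · M) N j ⟩
    ∑[ k < n ] (lookup (v · M) k * entry N k j)                      ≈⟨ sum-cong-≋ {n} (λ k → *-congʳ (lookup-· v M k)) ⟩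
    ∑[ k < n ] (∑[ i < n ] (lookup v i * entry M i k) * entry N k j) ≈⟨ sum-cong-≋ {n} (λ k → *-distribʳ-sum (entry N k j) (λ i → lookup v i * entry M i k)) ⟩
    ∑[ k < n ] ∑[ i < n ] (lookup v i * entry M i k * entry N k j)   ≈⟨ ∑-comm (λ k i → lookup v i * entry M i k * entry N k j) ⟩
    ∑[ i < n ] ∑[ k < n ] (lookup v i * entry M i k * entry N k j)   ≈⟨ sum-cong-≋ {n} (λ i → sum-cong-≋ {n} (λ k → *-assoc _ _ _)) ⟩
    ∑[ i < n ] ∑[ k < n ] (lookup v i * (entry M i k * entry N k j)) ≈⟨ sum-cong-≋ {n} (λ i → ≈-sym (*-distribˡ-sum (lookup v i) (λ k → entry M i k * entry N k j))) ⟩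
    ∑[ i < n ] (lookup v i * ∑[ k < n ] (entry M i k * entry N k j)) ≈⟨ sum-cong-≋ {n} (λ i → *-congˡ (≈-sym (entry-∙ M N i j))) ⟩
    ∑[ i < n ] (lookup v i * entry (M ∙ N) i j)                      ≈⟨ ≈-sym (lookup-· v (M ∙ N) j) ⟩
    lookup (v · (M ∙ N)) j                                           ∎

  lookup-▸ : ∀ {n} (M : Matrix n) u i → lookup (M ▸ u) i ≈ ∑[ k < n ] (entry M i k * lookup u k)
  lookup-▸ M u i = begin
    lookup (M ▸ u) i        ≡⟨ lookup-map i _ M ⟩
    inner (lookup M i) u      ≈⟨ inner≈∑ (lookup M i) u ⟩
    ∑[ k < _ ] (entry M i k * lookup u k) ∎

  ▸-∙ : ∀ {n} (M N : Matrix n) u i → lookup (M ▸ N ▸ u) i ≈ lookup ((M ∙ N) ▸ u) i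
  ▸-∙ {n} M N u i = begin
    lookup (M ▸ N ▸ u) i                                              ≈⟨ lookup-▸ M (N ▸ u) i ⟩
    ∑[ k < n ] (entry M i k * lookup (N ▸ u) k)                       ≈⟨ sum-cong-≋ {n} (λ k → *-congˡ (lookup-▸ N u k)) ⟩
    ∑[ k < n ] (entry M i k * ∑[ l < n ] (entry N k l * lookup u l))  ≈⟨ sum-cong-≋ {n} (λ k → *-distribˡ-sum (entry M i k) (λ l → entry N k l * lookup u l)) ⟩
    ∑[ k < n ] ∑[ l < n ] (entry M i k * (entry N k l * lookup u l))  ≈⟨ ∑-comm (λ k l → entry M i k * (entry N k l * lookup u l)) ⟩
    ∑[ l < n ] ∑[ k < n ] (entry M i k * (entry N k l * lookup u l))  ≈⟨ sum-cong-≋ {n} (λ l → sum-cong-≋ {n} (λ k → ≈-sym (*-assoc _ _ _))) ⟩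
    ∑[ l < n ] ∑[ k < n ] (entry M i k * entry N k l * lookup u l)    ≈⟨ sum-cong-≋ {n} (λ l → ≈-sym (*-distribʳ-sum (lookup u l) (λ k → entry M i k * entry N k l))) ⟩
    ∑[ l < n ] (∑[ k < n ] (entry M i k * entry N k l) * lookup u l)  ≈⟨ sum-cong-≋ {n} (λ l → *-congʳ (≈-sym (entry-∙ M N i l))) ⟩
    ∑[ l < n ] (entry (M ∙ N) i l * lookup u l)                       ≈⟨ ≈-sym (lookup-▸ (M ∙ N) u i) ⟩
    lookup ((M ∙ N) ▸ u) i                                            ∎

  inner-comm : ∀ {n} (u v : Vec Carrier n) → inner u v ≈ inner v u
  inner-comm {n} u v = begin
    inner u v                              ≈⟨ inner≈∑ u v ⟩
    ∑[ i < n ] (lookup u i * lookup v i) ≈⟨ sum-cong-≋ {n} (λ i → *-comm _ _) ⟩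
    ∑[ i < n ] (lookup v i * lookup u i) ≈⟨ ≈-sym (inner≈∑ v u) ⟩
    inner v u                              ∎

  inner-· : ∀ {n} (u v : Vec Carrier n) M → inner u (v · M) ≈ inner (M ▸ u) v
  inner-· {n} u v M = begin
    inner u (v · M)                                                    ≈⟨ inner≈∑ u (v · M) ⟩
    ∑[ j < n ] (lookup u j * lookup (v · M) j)                       ≈⟨ sum-cong-≋ {n} (λ j → *-congˡ (lookup-· v M j)) ⟩
    ∑[ j < n ] (lookup u j * ∑[ i < n ] (lookup v i * entry M i j))  ≈⟨ sum-cong-≋ {n} (λ j → *-distribˡ-sum (lookup u j) (λ i → lookup v i * entry M i j)) ⟩
    ∑[ j < n ] ∑[ i < n ] (lookup u j * (lookup v i * entry M i j))  ≈⟨ ∑-comm (λ j i → lookup u j * (lookup v i * entry M i j)) ⟩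
    ∑[ i < n ] ∑[ j < n ] (lookup u j * (lookup v i * entry M i j))  ≈⟨ sum-cong-≋ {n} (λ i → sum-cong-≋ {n} (λ j → rearrange (lookup u j) (lookup v i) (entry M i j))) ⟩
    ∑[ i < n ] ∑[ j < n ] (entry M i j * lookup u j * lookup v i)    ≈⟨ sum-cong-≋ {n} (λ i → ≈-sym (*-distribʳ-sum (lookup v i) (λ j → entry M i j * lookup u j))) ⟩
    ∑[ i < n ] (∑[ j < n ] (entry M i j * lookup u j) * lookup v i)  ≈⟨ sum-cong-≋ {n} (λ i → *-congʳ (≈-sym (lookup-▸ M u i))) ⟩
    ∑[ i < n ] (lookup (M ▸ u) i * lookup v i)                       ≈⟨ ≈-sym (inner≈∑ (M ▸ u) v) ⟩
    inner (M ▸ u) v                                                    ∎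
    where
    rearrange : ∀ x y z → x * (y * z) ≈ z * x * y
    rearrange x y z = ≈-trans (≈-sym (*-assoc x y z)) (≈-trans (*-comm (x * y) z) (≈-sym (*-assoc z x y)))

  inner-distribˡ-+ : ∀ {n} (u v w : Vec Carrier n) → inner u (zipWith _+_ v w) ≈ inner u v + inner u w
  inner-distribˡ-+ [] [] [] = ≈-sym (+-identityˡ 0#)
  inner-distribˡ-+ (x ∷ u) (y ∷ v) (z ∷ w) = begin
    x * (y + z) + inner u (zipWith _+_ v w)   ≈⟨ +-cong (distribˡ x y z) (inner-distribˡ-+ u v w) ⟩
    (x * y + x * z) + (inner u v + inner u w)   ≈⟨ +-assoc _ _ _ ⟩
    x * y + (x * z + (inner u v + inner u w))   ≈⟨ +-congˡ (≈-sym (+-assoc _ _ _)) ⟩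
    x * y + ((x * z + inner u v) + inner u w)   ≈⟨ +-congˡ (+-congʳ (+-comm _ _)) ⟩
    x * y + ((inner u v + x * z) + inner u w)   ≈⟨ +-congˡ (+-assoc _ _ _) ⟩
    x * y + (inner u v + (x * z + inner u w))   ≈⟨ ≈-sym (+-assoc _ _ _) ⟩
    (x * y + inner u v) + (x * z + inner u w)   ∎

  ∑-δ : ∀ {n} (f : Fin n → Carrier) j → (∀ i → i ≢ j → f i ≈ 0#) → ∑[ i < n ] f i ≈ f j
  ∑-δ {ℕ.suc n} f zero    off = ≈-trans (+-congˡ (≈-trans (sum-cong-≋ {n} (λ i → off (suc i) λ ())) (sum-replicate-zero n))) (+-identityʳ _)
  ∑-δ f (suc j) off = ≈-trans (+-congʳ (off zero λ ())) (≈-trans (+-identityˡ _) (∑-δ (λ i → f (suc i)) j (λ i i≢j → off (suc i) (λ e → i≢j (suc-injective e)))))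

  lookup-·-single : ∀ {n} v (M : Matrix n) j k → (∀ i → i ≢ k → entry M i j ≈ 0#) → lookup (v · M) j ≈ lookup v k * entry M k j
  lookup-·-single v M j k off = ≈-trans (lookup-· v M j) (∑-δ _ k (λ i i≢k → ≈-trans (*-congˡ (off i i≢k)) (zeroʳ _)))

  ▸-distrib-+ : ∀ {m n} (M : Vec (Vec Carrier n) m) u v i → lookup (M ▸ zipWith _+_ u v) i ≈ lookup (zipWith _+_ (M ▸ u) (M ▸ v)) i
  ▸-distrib-+ M u v i = begin
    lookup (M ▸ zipWith _+_ u v) i              ≡⟨ lookup-map i _ M ⟩
    inner (lookup M i) (zipWith _+_ u v)          ≈⟨ inner-distribˡ-+ (lookup M i) u v ⟩
    inner (lookup M i) u + inner (lookup M i) v     ≡⟨ cong₂ _+_ (lookup-map i _ M) (lookup-map i _ M) ⟨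
    lookup (M ▸ u) i + lookup (M ▸ v) i         ≡⟨ lookup-zipWith _+_ i (M ▸ u) (M ▸ v) ⟨
    lookup (zipWith _+_ (M ▸ u) (M ▸ v)) i      ∎

∀-Vec? : ∀ n {p} {P : Vec Bool n → Set p} → (∀ v → Dec (P v)) → Dec (∀ v → P v)
∀-Vec? ℕ.zero    P? = map′ (λ p → λ { [] → p }) (λ ∀p → ∀p []) (P? [])
∀-Vec? (ℕ.suc n) P? = map′ (λ (t , f) → λ { (true ∷ v) → t v ; (false ∷ v) → f v })
  (λ ∀p → ∀p ∘ (true ∷_) , ∀p ∘ (false ∷_))
  (∀-Vec? n (P? ∘ (true ∷_)) ×-dec ∀-Vec? n (P? ∘ (false ∷_)))

∃-Vec? : ∀ n {p} {P : Vec Bool n → Set p} → (∀ v → Dec (P v)) → Dec (∃ P)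
∃-Vec? ℕ.zero    P? = map′ ([] ,_) (λ { ([] , p) → p }) (P? [])
∃-Vec? (ℕ.suc n) P? = map′ (λ { (inj₁ (v , p)) → true ∷ v , p ; (inj₂ (v , p)) → false ∷ v , p })
  (λ { (true ∷ v , p) → inj₁ (v , p) ; (false ∷ v , p) → inj₂ (v , p) })
  (∃-Vec? n (P? ∘ (true ∷_)) ⊎-dec ∃-Vec? n (P? ∘ (false ∷_)))

∀-Bool? : ∀ {p} {P : Bool → Set p} → (∀ b → Dec (P b)) → Dec (∀ b → P b)
∀-Bool? P? = map′ (λ (t , f) → λ { true → t ; false → f }) (λ ∀p → ∀p true , ∀p false) (P? true ×-dec P? false)

-- The action of GL(4,2) on Ω

module 𝔽₂ = LinearAlgebra (CommutativeRing.commutativeSemiring xor-∧-commutativeRing)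

infix 4 _≟⁴_
_≟⁴_ : DecidableEquality F2⁴
_≟⁴_ = ≡-dec Bool._≟_

bits-fromBits : ∀ v → bits (fromBits v) ≡ v
bits-fromBits = from-yes (∀-Vec? 4 λ v → bits (fromBits v) ≟⁴ v)

fromBits-bits : ∀ ω → fromBits (bits ω) ≡ ω
fromBits-bits = from-yes (all? λ ω → fromBits (bits ω) Fin.≟ ω)

·₂-identityʳ : ∀ v → v ·₂ I₂ 4 ≡ v
·₂-identityʳ = from-yes (∀-Vec? 4 λ v → v ·₂ I₂ 4 ≟⁴ v)

▸-identityˡ : ∀ v → I₂ 4 𝔽₂.▸ v ≡ v
▸-identityˡ = from-yes (∀-Vec? 4 λ v → I₂ 4 𝔽₂.▸ v ≟⁴ v)

dot-ω₀ : ∀ l → dot l (bits ω₀) ≡ false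
dot-ω₀ = from-yes (∀-Vec? 4 λ l → dot l (bits ω₀) Bool.≟ false)

ω₀-▹ : ∀ g → ω₀ ▹ g ≡ ω₀
ω₀-▹ (r₁ ∷ r₂ ∷ r₃ ∷ r₄ ∷ []) = refl

bits-▹ : ∀ ω g → bits (ω ▹ g) ≡ bits ω ·₂ g
bits-▹ ω g = bits-fromBits (bits ω ·₂ g)

dot-▹ : ∀ l ω g → dot l (bits (ω ▹ g)) ≡ dot (g 𝔽₂.▸ l) (bits ω)
dot-▹ l ω g = trans (cong (dot l) (bits-▹ ω g)) (𝔽₂.inner-· l (bits ω) g)

▹-▹-inverse : ∀ {g N} → g *₂ N ≡ I₂ 4 → ∀ ω → (ω ▹ g) ▹ N ≡ ω
▹-▹-inverse {g} {N} gN≡I ω = begin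
  fromBits (bits (ω ▹ g) ·₂ N) ≡⟨ cong (λ v → fromBits (v ·₂ N)) (bits-▹ ω g) ⟩
  fromBits ((bits ω ·₂ g) ·₂ N) ≡⟨ cong fromBits (vec-ext (𝔽₂.·-∙ (bits ω) g N)) ⟩
  fromBits (bits ω ·₂ (g *₂ N)) ≡⟨ cong (λ M → fromBits (bits ω ·₂ M)) gN≡I ⟩
  fromBits (bits ω ·₂ I₂ 4)     ≡⟨ cong fromBits (·₂-identityʳ (bits ω)) ⟩
  fromBits (bits ω)             ≡⟨ fromBits-bits ω ⟩
  ω                             ∎
  where open ≡-Reasoning

▸-▸-inverse : ∀ {g N} → g *₂ N ≡ I₂ 4 → ∀ m → g 𝔽₂.▸ N 𝔽₂.▸ m ≡ m
▸-▸-inverse {g} {N} gN≡I m = begin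
  g 𝔽₂.▸ N 𝔽₂.▸ m   ≡⟨ vec-ext (𝔽₂.▸-∙ g N m) ⟩
  (g *₂ N) 𝔽₂.▸ m   ≡⟨ cong (𝔽₂._▸ m) gN≡I ⟩
  I₂ 4 𝔽₂.▸ m       ≡⟨ ▸-identityˡ m ⟩
  m                 ∎
  where open ≡-Reasoning

injective⇒surjective : ∀ {n} {f : Fin n → Fin n} → (∀ {i j} → f i ≡ f j → i ≡ j) → ∀ y → ∃ λ x → f x ≡ y
injective⇒surjective {ℕ.zero}  inj ()
injective⇒surjective {ℕ.suc n} {f} inj y with any? (λ x → f x Fin.≟ y)
... | yes hit = hit
... | no miss = contradiction (injective⇒≤ squeezed-injective) ℕ.1+n≰n
  where
  squeeze : Fin (ℕ.suc n) → Fin n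
  squeeze x = punchOut {i = y} (λ y≡fx → miss (x , sym y≡fx))
  squeezed-injective : ∀ {x x′} → squeeze x ≡ squeeze x′ → x ≡ x′
  squeezed-injective {x} {x′} eq = inj (punchOut-injective {i = y} (λ y≡fx → miss (x , sym y≡fx)) (λ y≡fx → miss (x′ , sym y≡fx)) eq)

▹-injective : ∀ {g} → InGL 4 g → ∀ {ω η} → ω ▹ g ≡ η ▹ g → ω ≡ η
▹-injective (N , gN≡I) {ω} {η} eq =
  trans (sym (▹-▹-inverse gN≡I ω)) (trans (cong (_▹ N) eq) (▹-▹-inverse gN≡I η))

▹-permutation : ∀ {g} → InGL 4 g → Permutation′ 16
▹-permutation {g} g∈GL = permutation (_▹ g) (proj₁ ∘ onto) (proj₂ ∘ onto) (λ ω → ▹-injective g∈GL (proj₂ (onto (ω ▹ g))))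
  where onto = injective⇒surjective (▹-injective g∈GL)

-- Signed permutation matrices

module ℤᴸ = LinearAlgebra ℤ.+-*-commutativeSemiring
open ℤᴸ using (sum-syntax; sum-cong-≋; sum-permute; entry)

sgn : Bool → ℤ
sgn b = if b then ℤ.- + 1 else + 1

sgn-xor : ∀ a c → sgn (a xor c) ≡ sgn a ℤ.* sgn c
sgn-xor false c     = sym (ℤ.*-identityˡ (sgn c))
sgn-xor true  false = refl
sgn-xor true  true  = refl

imbalance : Sub → ℤ
imbalance A = ∑[ ω < 16 ] sgn (lookup A ω)

walsh : Sub → F2⁴ → ℤ
walsh A m = imbalance (A +ₛ Cset m)

entry-tabulate : ∀ {n} (f : Fin n → Fin n → ℤ) i j → entry (tabulate (λ i → tabulate (f i))) i j ≡ f i j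
entry-tabulate f i j = trans (cong (λ r → lookup r j) (lookup∘tabulate _ i)) (lookup∘tabulate (f i) j)

⌊≟⌋-refl : ∀ {n} (i : Fin n) → ⌊ i Fin.≟ i ⌋ ≡ true
⌊≟⌋-refl i = trans (isYes≗does (i Fin.≟ i)) (dec-true (i Fin.≟ i) refl)

⌊≟⌋-≢ : ∀ {n} {i j : Fin n} → i ≢ j → ⌊ i Fin.≟ j ⌋ ≡ false
⌊≟⌋-≢ {i = i} {j} i≢j = trans (isYes≗does (i Fin.≟ j)) (dec-false (i Fin.≟ j) i≢j)

diagonal : ∀ {n} → (Fin n → ℤ) → Mat n
diagonal d = tabulate (λ i → tabulate (λ j → if ⌊ i Fin.≟ j ⌋ then d i else + 0))

lookup-⋆-diagonal : ∀ {n} x (d : Fin n → ℤ) j → lookup (x ⋆ diagonal d) j ≡ lookup x j ℤ.* d j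
lookup-⋆-diagonal x d j = trans (ℤᴸ.lookup-·-single x (diagonal d) j j off) (cong (lookup x j ℤ.*_) on)
  where
  off : ∀ i → i ≢ j → entry (diagonal d) i j ≡ + 0
  off i i≢j = trans (entry-tabulate (λ i j → if ⌊ i Fin.≟ j ⌋ then d i else + 0) i j) (cong (if_then d i else + 0) (⌊≟⌋-≢ i≢j))
  on : entry (diagonal d) j j ≡ d j
  on = trans (entry-tabulate (λ i j → if ⌊ i Fin.≟ j ⌋ then d i else + 0) j j) (cong (if_then d j else + 0) (⌊≟⌋-refl j))

lookup-⋆-εM : ∀ x A j → lookup (x ⋆ εM A) j ≡ lookup x j ℤ.* sgn (lookup A j)
lookup-⋆-εM x A = lookup-⋆-diagonal x (sgn ∘ lookup A)

lookup-x₀⋆εM : ∀ B j → lookup (x₀ ⋆ εM B) j ≡ sgn (lookup B j)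
lookup-x₀⋆εM B j = trans (lookup-⋆-εM x₀ B j) (trans (cong (ℤ._* sgn (lookup B j)) (lookup-replicate j (+ 1))) (ℤ.*-identityˡ _))

⋆-identityʳ : ∀ x → x ⋆ Iₘ 16 ≡ x
⋆-identityʳ x = vec-ext (λ j → trans (lookup-⋆-diagonal x (λ _ → + 1) j) (ℤ.*-identityʳ (lookup x j)))

⋆-∙ : ∀ {n} x (M N : Mat n) → x ⋆ (M *ₘ N) ≡ (x ⋆ M) ⋆ N
⋆-∙ x M N = sym (vec-ext (ℤᴸ.·-∙ x M N))

lookup-⋆-PM : ∀ {g} → InGL 4 g → ∀ x ω → lookup (x ⋆ PM g) (ω ▹ g) ≡ lookup x ω
lookup-⋆-PM {g} g∈GL x ω = trans (ℤᴸ.lookup-·-single x (PM g) (ω ▹ g) ω off) (trans (cong (lookup x ω ℤ.*_) on) (ℤ.*-identityʳ _))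
  where
  permutationEntry : Ω → Ω → ℤ
  permutationEntry i j = if ⌊ j Fin.≟ (i ▹ g) ⌋ then + 1 else + 0
  off : ∀ i → i ≢ ω → entry (PM g) i (ω ▹ g) ≡ + 0
  off i i≢ω = trans (entry-tabulate permutationEntry i (ω ▹ g)) (cong (if_then + 1 else + 0) (⌊≟⌋-≢ (λ eq → i≢ω (▹-injective g∈GL (sym eq)))))
  on : entry (PM g) ω (ω ▹ g) ≡ + 1
  on = trans (entry-tabulate permutationEntry ω (ω ▹ g)) (cong (if_then + 1 else + 0) (⌊≟⌋-refl (ω ▹ g)))

sgn-cancel : ∀ a c b → (a ℤ.* sgn b) ℤ.* (c ℤ.* sgn b) ≡ a ℤ.* c
sgn-cancel a c false = cong₂ ℤ._*_ (ℤ.*-identityʳ a) (ℤ.*-identityʳ c)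
sgn-cancel a c true  = negated-twice a c
  where
  negated-twice : ∀ a c → (a ℤ.* ℤ.- + 1) ℤ.* (c ℤ.* ℤ.- + 1) ≡ a ℤ.* c
  negated-twice = solve-∀

∑-▹ : ∀ {g} → InGL 4 g → (f : Ω → ℤ) → ∑[ j < 16 ] f j ≡ ∑[ ω < 16 ] f (ω ▹ g)
∑-▹ g∈GL f = sum-permute f (▹-permutation g∈GL)

vec-ext-▹ : ∀ {g} → InGL 4 g → ∀ {u v : Vec ℤ 16} → (∀ ω → lookup u (ω ▹ g) ≡ lookup v (ω ▹ g)) → u ≡ v
vec-ext-▹ g∈GL {u} {v} eq = vec-ext λ j → subst (λ j → lookup u j ≡ lookup v j) (inverseʳ π) (eq (π ⟨$⟩ˡ j))
  where π = ▹-permutation g∈GL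

lookup-⋆-signedPermutation : ∀ {g} → InGL 4 g → ∀ x A ω → lookup (x ⋆ (εM A *ₘ PM g)) (ω ▹ g) ≡ lookup x ω ℤ.* sgn (lookup A ω)
lookup-⋆-signedPermutation {g} g∈GL x A ω = begin
  lookup (x ⋆ (εM A *ₘ PM g)) (ω ▹ g)   ≡⟨ cong (λ v → lookup v (ω ▹ g)) (⋆-∙ x (εM A) (PM g)) ⟩
  lookup ((x ⋆ εM A) ⋆ PM g) (ω ▹ g)    ≡⟨ lookup-⋆-PM g∈GL (x ⋆ εM A) ω ⟩
  lookup (x ⋆ εM A) ω                   ≡⟨ lookup-⋆-εM x A ω ⟩
  lookup x ω ℤ.* sgn (lookup A ω)       ∎
  where open ≡-Reasoning

lookup-x₀⋆signedPermutation : ∀ {g} → InGL 4 g → ∀ A ω → lookup (x₀ ⋆ (εM A *ₘ PM g)) (ω ▹ g) ≡ sgn (lookup A ω)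
lookup-x₀⋆signedPermutation g∈GL A ω = trans (lookup-⋆-signedPermutation g∈GL x₀ A ω) (trans (cong (ℤ._* sgn (lookup A ω)) (lookup-replicate ω (+ 1))) (ℤ.*-identityˡ _))

ip-⋆-εM : ∀ A u v → ip (u ⋆ εM A) (v ⋆ εM A) ≡ ip u v
ip-⋆-εM A u v = begin
  ip (u ⋆ εM A) (v ⋆ εM A)                                                         ≡⟨ ℤᴸ.inner≈∑ (u ⋆ εM A) (v ⋆ εM A) ⟩
  ∑[ j < 16 ] (lookup (u ⋆ εM A) j ℤ.* lookup (v ⋆ εM A) j)                        ≡⟨ sum-cong-≋ {16} (λ j → cong₂ ℤ._*_ (lookup-⋆-εM u A j) (lookup-⋆-εM v A j)) ⟩
  ∑[ j < 16 ] ((lookup u j ℤ.* sgn (lookup A j)) ℤ.* (lookup v j ℤ.* sgn (lookup A j))) ≡⟨ sum-cong-≋ {16} (λ j → sgn-cancel (lookup u j) (lookup v j) (lookup A j)) ⟩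
  ∑[ j < 16 ] (lookup u j ℤ.* lookup v j)                                          ≡⟨ ℤᴸ.inner≈∑ u v ⟨
  ip u v                                                                           ∎
  where open ≡-Reasoning

ip-⋆-PM : ∀ {g} → InGL 4 g → ∀ u v → ip (u ⋆ PM g) (v ⋆ PM g) ≡ ip u v
ip-⋆-PM {g} g∈GL u v = begin
  ip (u ⋆ PM g) (v ⋆ PM g)                                               ≡⟨ ℤᴸ.inner≈∑ (u ⋆ PM g) (v ⋆ PM g) ⟩
  ∑[ j < 16 ] (lookup (u ⋆ PM g) j ℤ.* lookup (v ⋆ PM g) j)              ≡⟨ ∑-▹ g∈GL (λ j → lookup (u ⋆ PM g) j ℤ.* lookup (v ⋆ PM g) j) ⟩
  ∑[ ω < 16 ] (lookup (u ⋆ PM g) (ω ▹ g) ℤ.* lookup (v ⋆ PM g) (ω ▹ g))  ≡⟨ sum-cong-≋ {16} (λ ω → cong₂ ℤ._*_ (lookup-⋆-PM g∈GL u ω) (lookup-⋆-PM g∈GL v ω)) ⟩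
  ∑[ ω < 16 ] (lookup u ω ℤ.* lookup v ω)                                ≡⟨ ℤᴸ.inner≈∑ u v ⟨
  ip u v                                                                 ∎
  where open ≡-Reasoning

ip-⋆-signedPermutation : ∀ {g} → InGL 4 g → ∀ A u v → ip (u ⋆ (εM A *ₘ PM g)) (v ⋆ (εM A *ₘ PM g)) ≡ ip u v
ip-⋆-signedPermutation {g} g∈GL A u v = begin
  ip (u ⋆ (εM A *ₘ PM g)) (v ⋆ (εM A *ₘ PM g))  ≡⟨ cong₂ ip (⋆-∙ u (εM A) (PM g)) (⋆-∙ v (εM A) (PM g)) ⟩
  ip ((u ⋆ εM A) ⋆ PM g) ((v ⋆ εM A) ⋆ PM g)    ≡⟨ ip-⋆-PM g∈GL (u ⋆ εM A) (v ⋆ εM A) ⟩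
  ip (u ⋆ εM A) (v ⋆ εM A)                      ≡⟨ ip-⋆-εM A u v ⟩
  ip u v                                        ∎
  where open ≡-Reasoning

⋆-εM-εM : ∀ x A B → (x ⋆ εM A) ⋆ εM B ≡ x ⋆ εM (A +ₛ B)
⋆-εM-εM x A B = vec-ext λ j → begin
  lookup ((x ⋆ εM A) ⋆ εM B) j                                ≡⟨ lookup-⋆-εM (x ⋆ εM A) B j ⟩
  lookup (x ⋆ εM A) j ℤ.* sgn (lookup B j)                    ≡⟨ cong (ℤ._* sgn (lookup B j)) (lookup-⋆-εM x A j) ⟩
  lookup x j ℤ.* sgn (lookup A j) ℤ.* sgn (lookup B j)        ≡⟨ ℤ.*-assoc (lookup x j) _ _ ⟩
  lookup x j ℤ.* (sgn (lookup A j) ℤ.* sgn (lookup B j))      ≡⟨ cong (lookup x j ℤ.*_) (trans (cong sgn (lookup-zipWith _xor_ j A B)) (sgn-xor (lookup A j) (lookup B j))) ⟨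
  lookup x j ℤ.* sgn (lookup (A +ₛ B) j)                      ≡⟨ lookup-⋆-εM x (A +ₛ B) j ⟨
  lookup (x ⋆ εM (A +ₛ B)) j                                  ∎
  where open ≡-Reasoning

+ₛ-identityʳ : ∀ A → A +ₛ ∅ ≡ A
+ₛ-identityʳ A = vec-ext λ ω → trans (lookup-zipWith _xor_ ω A ∅) (trans (cong (lookup A ω xor_) (lookup-replicate ω false)) (xor-identityʳ _))

x₀⋆εM-∅ : x₀ ⋆ εM ∅ ≡ x₀
x₀⋆εM-∅ = vec-ext λ j → trans (lookup-⋆-εM x₀ ∅ j) (trans (cong (λ b → lookup x₀ j ℤ.* sgn b) (lookup-replicate j false)) (ℤ.*-identityʳ _))

ip-x₀-x₀⋆εM : ∀ B → ip x₀ (x₀ ⋆ εM B) ≡ imbalance B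
ip-x₀-x₀⋆εM B = trans (ℤᴸ.inner≈∑ x₀ (x₀ ⋆ εM B)) (sum-cong-≋ {16} λ j →
  trans (cong₂ ℤ._*_ (lookup-replicate j (+ 1)) (lookup-x₀⋆εM B j)) (ℤ.*-identityˡ _))

ip-x₀⋆signedPermutation : ∀ {g} → InGL 4 g → ∀ A {B B′} → (∀ ω → lookup B (ω ▹ g) ≡ lookup B′ ω) →
  ip (x₀ ⋆ (εM A *ₘ PM g)) (x₀ ⋆ εM B) ≡ imbalance (A +ₛ B′)
ip-x₀⋆signedPermutation {g} g∈GL A {B} {B′} pullback = begin
  ip (x₀ ⋆ h) (x₀ ⋆ εM B)                                                 ≡⟨ ℤᴸ.inner≈∑ (x₀ ⋆ h) (x₀ ⋆ εM B) ⟩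
  ∑[ j < 16 ] (lookup (x₀ ⋆ h) j ℤ.* lookup (x₀ ⋆ εM B) j)                ≡⟨ ∑-▹ g∈GL (λ j → lookup (x₀ ⋆ h) j ℤ.* lookup (x₀ ⋆ εM B) j) ⟩
  ∑[ ω < 16 ] (lookup (x₀ ⋆ h) (ω ▹ g) ℤ.* lookup (x₀ ⋆ εM B) (ω ▹ g))    ≡⟨ sum-cong-≋ {16} (λ ω → cong₂ ℤ._*_ (lookup-x₀⋆signedPermutation g∈GL A ω) (x₀-at-B ω)) ⟩
  ∑[ ω < 16 ] (sgn (lookup A ω) ℤ.* sgn (lookup B′ ω))                    ≡⟨ sum-cong-≋ {16} (λ ω → trans (cong sgn (lookup-zipWith _xor_ ω A B′)) (sgn-xor (lookup A ω) (lookup B′ ω))) ⟨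
  imbalance (A +ₛ B′)                                                     ∎
  where
  open ≡-Reasoning
  h = εM A *ₘ PM g
  x₀-at-B : ∀ ω → lookup (x₀ ⋆ εM B) (ω ▹ g) ≡ sgn (lookup B′ ω)
  x₀-at-B ω = trans (lookup-x₀⋆εM B (ω ▹ g)) (cong sgn (pullback ω))

ip-x₀⋆signedPermutation-x₀ : ∀ {g} → InGL 4 g → ∀ A → ip (x₀ ⋆ (εM A *ₘ PM g)) x₀ ≡ imbalance A
ip-x₀⋆signedPermutation-x₀ {g} g∈GL A = begin
  ip (x₀ ⋆ (εM A *ₘ PM g)) x₀            ≡⟨ cong (ip (x₀ ⋆ (εM A *ₘ PM g))) x₀⋆εM-∅ ⟨
  ip (x₀ ⋆ (εM A *ₘ PM g)) (x₀ ⋆ εM ∅)   ≡⟨ ip-x₀⋆signedPermutation g∈GL A {∅} {∅} (λ ω → trans (lookup-replicate (ω ▹ g) false) (sym (lookup-replicate ω false))) ⟩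
  imbalance (A +ₛ ∅)                     ≡⟨ cong imbalance (+ₛ-identityʳ A) ⟩
  imbalance A                            ∎
  where open ≡-Reasoning

ip-⋆-εM-swap : ∀ A u v → ip (u ⋆ εM A) v ≡ ip u (v ⋆ εM A)
ip-⋆-εM-swap A u v = begin
  ip (u ⋆ εM A) v                                           ≡⟨ ℤᴸ.inner≈∑ (u ⋆ εM A) v ⟩
  ∑[ j < 16 ] (lookup (u ⋆ εM A) j ℤ.* lookup v j)          ≡⟨ sum-cong-≋ {16} (λ j → trans (cong (ℤ._* lookup v j) (lookup-⋆-εM u A j)) (shuffle (lookup u j) (sgn (lookup A j)) (lookup v j))) ⟩
  ∑[ j < 16 ] (lookup u j ℤ.* (lookup v j ℤ.* sgn (lookup A j))) ≡⟨ sum-cong-≋ {16} (λ j → cong (lookup u j ℤ.*_) (lookup-⋆-εM v A j)) ⟨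
  ∑[ j < 16 ] (lookup u j ℤ.* lookup (v ⋆ εM A) j)          ≡⟨ ℤᴸ.inner≈∑ u (v ⋆ εM A) ⟨
  ip u (v ⋆ εM A)                                           ∎
  where
  open ≡-Reasoning
  shuffle : ∀ a s c → (a ℤ.* s) ℤ.* c ≡ a ℤ.* (c ℤ.* s)
  shuffle = solve-∀

IsSign : ℤ → Set
IsSign z = z ≡ + 1 ⊎ z ≡ ℤ.- + 1

SignVector : ∀ {n} → Vec ℤ n → Set
SignVector = Vec-All.All IsSign

sgn-isSign : ∀ b → IsSign (sgn b)
sgn-isSign false = inj₁ refl
sgn-isSign true  = inj₂ refl

isSign-* : ∀ {a c} → IsSign a → IsSign c → IsSign (a ℤ.* c)
isSign-* (inj₁ refl) (inj₁ refl) = inj₁ refl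
isSign-* (inj₁ refl) (inj₂ refl) = inj₂ refl
isSign-* (inj₂ refl) (inj₁ refl) = inj₂ refl
isSign-* (inj₂ refl) (inj₂ refl) = inj₁ refl

signVector-⋆-εM : ∀ {v} A → SignVector v → SignVector (v ⋆ εM A)
signVector-⋆-εM {v} A v± = lookup⁻ λ j →
  subst IsSign (sym (lookup-⋆-εM v A j)) (isSign-* (lookup⁺ v± j) (sgn-isSign (lookup A j)))

signVector-x₀ : SignVector x₀
signVector-x₀ = lookup⁻ λ j → inj₁ (lookup-replicate j (+ 1))

signVector-⋆-PM : ∀ {g v} → InGL 4 g → SignVector v → SignVector (v ⋆ PM g)
signVector-⋆-PM {g} {v} g∈GL v± = lookup⁻ λ j →
  subst (λ j → IsSign (lookup (v ⋆ PM g) j)) (inverseʳ π) (subst IsSign (sym (lookup-⋆-PM g∈GL v (π ⟨$⟩ˡ j))) (lookup⁺ v± (π ⟨$⟩ˡ j)))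
  where π = ▹-permutation g∈GL

ip-self : ∀ {n} {v : Vec ℤ n} → SignVector v → ip v v ≡ + n
ip-self []               = refl
ip-self (inj₁ refl ∷ v±) = cong (ℤ._+_ (+ 1)) (ip-self v±)
ip-self (inj₂ refl ∷ v±) = cong (ℤ._+_ (+ 1)) (ip-self v±)

ip-≤ : ∀ {n} {u v : Vec ℤ n} → SignVector u → SignVector v → ip u v ℤ.≤ + n
ip-≤ []       []       = ℤ.≤-refl
ip-≤ (a ∷ u±) (c ∷ v±) = ℤ.+-mono-≤ (product-≤ a c) (ip-≤ u± v±)
  where
  product-≤ : ∀ {a c} → IsSign a → IsSign c → a ℤ.* c ℤ.≤ + 1
  product-≤ (inj₁ refl) (inj₁ refl) = ℤ.≤-refl
  product-≤ (inj₁ refl) (inj₂ refl) = -≤+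
  product-≤ (inj₂ refl) (inj₁ refl) = -≤+
  product-≤ (inj₂ refl) (inj₂ refl) = ℤ.≤-refl

ip≡n⇒≡ : ∀ {n} {u v : Vec ℤ n} → SignVector u → SignVector v → ip u v ≡ + n → u ≡ v
ip≡n⇒≡ []               []               _  = refl
ip≡n⇒≡ (inj₁ refl ∷ u±) (inj₁ refl ∷ v±) eq = cong (+ 1 ∷_) (ip≡n⇒≡ u± v± (∙-cancelˡ (+ 1) _ _ eq))
ip≡n⇒≡ (inj₂ refl ∷ u±) (inj₂ refl ∷ v±) eq = cong (ℤ.- + 1 ∷_) (ip≡n⇒≡ u± v± (∙-cancelˡ (+ 1) _ _ eq))
ip≡n⇒≡ (inj₁ refl ∷ u±) (inj₂ refl ∷ v±) eq = contradiction eq (ℤ.<⇒≢ (ℤ.+-mono-<-≤ -<+ (ip-≤ u± v±)))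
ip≡n⇒≡ (inj₂ refl ∷ u±) (inj₁ refl ∷ v±) eq = contradiction eq (ℤ.<⇒≢ (ℤ.+-mono-<-≤ -<+ (ip-≤ u± v±)))

sameRay⇒≡ : ∀ {n} {u v : Vec ℤ n} → SignVector u → SignVector v → SameRay u v → u ≡ v
sameRay⇒≡ []       []       _            = refl
sameRay⇒≡ (a ∷ u±) (c ∷ v±) (k , l , eq) =
  cong₂ _∷_ (same-sign a c (cong Data.Vec.head eq)) (sameRay⇒≡ u± v± (k , l , cong Data.Vec.tail eq))
  where
  same-sign : ∀ {a c} → IsSign a → IsSign c → + ℕ.suc k ℤ.* a ≡ + ℕ.suc l ℤ.* c → a ≡ c
  same-sign (inj₁ refl) (inj₁ refl) _ = refl
  same-sign (inj₂ refl) (inj₂ refl) _ = refl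
  same-sign (inj₁ refl) (inj₂ refl) ()
  same-sign (inj₂ refl) (inj₁ refl) ()

signVector≢0 : ∀ {n} {v : Vec ℤ (ℕ.suc n)} → SignVector v → v ≢ replicate (ℕ.suc n) (+ 0)
signVector≢0 (inj₁ refl ∷ _) ()
signVector≢0 (inj₂ refl ∷ _) ()

-- Boolean functions of degree at most 2 and their Walsh coefficients

infixl 6 _+⁴_
_+⁴_ : F2⁴ → F2⁴ → F2⁴
_+⁴_ = zipWith _xor_

lookup-Cset : ∀ l ω → lookup (Cset l) ω ≡ dot l (bits ω)
lookup-Cset l = lookup∘tabulate (λ ω → dot l (bits ω))

dot-+⁴ : ∀ l m x → dot (l +⁴ m) x ≡ dot l x xor dot m x
dot-+⁴ l m x = begin
  dot (l +⁴ m) x            ≡⟨ 𝔽₂.inner-comm (l +⁴ m) x ⟩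
  dot x (l +⁴ m)            ≡⟨ 𝔽₂.inner-distribˡ-+ x l m ⟩
  dot x l xor dot x m       ≡⟨ cong₂ _xor_ (𝔽₂.inner-comm x l) (𝔽₂.inner-comm x m) ⟩
  dot l x xor dot m x       ∎
  where open ≡-Reasoning

Cset-+ : ∀ l m → Cset l +ₛ Cset m ≡ Cset (l +⁴ m)
Cset-+ l m = vec-ext λ ω → begin
  lookup (Cset l +ₛ Cset m) ω              ≡⟨ lookup-zipWith _xor_ ω (Cset l) (Cset m) ⟩
  lookup (Cset l) ω xor lookup (Cset m) ω  ≡⟨ cong₂ _xor_ (lookup-Cset l ω) (lookup-Cset m ω) ⟩
  dot l (bits ω) xor dot m (bits ω)        ≡⟨ dot-+⁴ l m (bits ω) ⟨
  dot (l +⁴ m) (bits ω)                    ≡⟨ lookup-Cset (l +⁴ m) ω ⟨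
  lookup (Cset (l +⁴ m)) ω                 ∎
  where open ≡-Reasoning

+⁴-cancelʳ : ∀ ℓ m → (ℓ +⁴ m) +⁴ m ≡ ℓ
+⁴-cancelʳ = from-yes (∀-Vec? 4 λ ℓ → ∀-Vec? 4 λ m → (ℓ +⁴ m) +⁴ m ≟⁴ ℓ)

affine : F2⁴ → Bool → Sub
affine l c = tabulate (λ ω → dot l (bits ω) xor c)

lookup-affine : ∀ l c ω → lookup (affine l c) ω ≡ dot l (bits ω) xor c
lookup-affine l c = lookup∘tabulate (λ ω → dot l (bits ω) xor c)

affine-+ : ∀ l c l′ c′ → affine l c +ₛ affine l′ c′ ≡ affine (l +⁴ l′) (c xor c′)
affine-+ l c l′ c′ = vec-ext λ ω → begin
  lookup (affine l c +ₛ affine l′ c′) ω                      ≡⟨ lookup-zipWith _xor_ ω (affine l c) (affine l′ c′) ⟩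
  lookup (affine l c) ω xor lookup (affine l′ c′) ω          ≡⟨ cong₂ _xor_ (lookup-affine l c ω) (lookup-affine l′ c′ ω) ⟩
  (dot l (bits ω) xor c) xor (dot l′ (bits ω) xor c′)        ≡⟨ interchange (dot l (bits ω)) c (dot l′ (bits ω)) c′ ⟩
  (dot l (bits ω) xor dot l′ (bits ω)) xor (c xor c′)        ≡⟨ cong (_xor (c xor c′)) (dot-+⁴ l l′ (bits ω)) ⟨
  dot (l +⁴ l′) (bits ω) xor (c xor c′)                      ≡⟨ lookup-affine (l +⁴ l′) (c xor c′) ω ⟨
  lookup (affine (l +⁴ l′) (c xor c′)) ω                     ∎
  where open ≡-Reasoning

affSub1⇒affine : ∀ {D} → AffSub 1 D → ∃₂ λ l c → D ≡ affine l c
affSub1⇒affine ((l ∷ []) , (c ∷ []) , _ , refl) = l , not c , vec-ext λ ω → begin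
  lookup (tabulate (λ ω → not (dot l (bits ω) xor c) ∧ true)) ω   ≡⟨ lookup∘tabulate (λ ω → not (dot l (bits ω) xor c) ∧ true) ω ⟩
  not (dot l (bits ω) xor c) ∧ true                              ≡⟨ ∧-identityʳ (not (dot l (bits ω) xor c)) ⟩
  not (dot l (bits ω) xor c)                                     ≡⟨ not-distribʳ-xor (dot l (bits ω)) c ⟩
  dot l (bits ω) xor not c                                       ≡⟨ lookup-affine l (not c) ω ⟨
  lookup (affine l (not c)) ω                                    ∎
  where open ≡-Reasoning

RM1⇒affine : ∀ {D} → RM 1 D → ∃₂ λ l c → D ≡ affine l c
RM1⇒affine (gens , gens-affine , refl) = sum-affine gens-affine
  where
  sum-affine : ∀ {gs} → All (AffSub 1) gs → ∃₂ λ l c → List.foldr _+ₛ_ ∅ gs ≡ affine l c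
  sum-affine [] = zero⁴ , false , refl
  sum-affine (g-affine ∷ gs-affine) with affSub1⇒affine g-affine | sum-affine gs-affine
  ... | l , c , refl | l′ , c′ , eq = l +⁴ l′ , c xor c′ , trans (cong (affine l c +ₛ_) eq) (affine-+ l c l′ c′)

RM1⇒Cset : ∀ {D} → RM 1 D → ω₀ ∉ₛ D → ∃ λ l → D ≡ Cset l
RM1⇒Cset D∈RM1 ω₀∉D with RM1⇒affine D∈RM1
... | l , c , refl = l , vec-ext λ ω → trans (lookup-affine l c ω) (trans (cong (dot l (bits ω) xor_) c≡false) (trans (xor-identityʳ _) (sym (lookup-Cset l ω))))
  where
  c≡false : c ≡ false
  c≡false = trans (sym (cong (_xor c) (dot-ω₀ l))) (trans (sym (lookup-affine l c ω₀)) ω₀∉D)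

imbalance-Cset : ∀ l → l ≡ zero⁴ ⊎ imbalance (Cset l) ≡ + 0
imbalance-Cset = from-yes (∀-Vec? 4 λ l → (l ≟⁴ zero⁴) ⊎-dec (imbalance (Cset l) ℤ.≟ + 0))

_⊆ᵇ_ : F2⁴ → F2⁴ → Bool
u ⊆ᵇ v = foldr _ _∧_ true (zipWith (λ a b → not a ∨ b) u v)

-- The supports of the monomials listed by `monomial`, in the same order. `anf` computes
-- the algebraic normal form by Möbius inversion: the coefficient of x^S is the parity of D
-- on {ω : supp ω ⊆ S}.
monomialSupports : Vec F2⁴ 11
monomialSupports =
  (false ∷ false ∷ false ∷ false ∷ []) ∷
  (true ∷ false ∷ false ∷ false ∷ []) ∷ (false ∷ true ∷ false ∷ false ∷ []) ∷
  (false ∷ false ∷ true ∷ false ∷ []) ∷ (false ∷ false ∷ false ∷ true ∷ []) ∷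
  (true ∷ true ∷ false ∷ false ∷ []) ∷ (true ∷ false ∷ true ∷ false ∷ []) ∷
  (true ∷ false ∷ false ∷ true ∷ []) ∷ (false ∷ true ∷ true ∷ false ∷ []) ∷
  (false ∷ true ∷ false ∷ true ∷ []) ∷ (false ∷ false ∷ true ∷ true ∷ []) ∷ []

monomial : F2⁴ → Vec Bool 11
monomial (a ∷ b ∷ c ∷ d ∷ []) = true ∷ a ∷ b ∷ c ∷ d ∷ a ∧ b ∷ a ∧ c ∷ a ∧ d ∷ b ∧ c ∷ b ∧ d ∷ c ∧ d ∷ []

monomials : Vec (Vec Bool 11) 16
monomials = tabulate (λ ω → monomial (bits ω))

moebius : Vec (Vec Bool 16) 11
moebius = Vec.map (λ s → tabulate (λ ω → bits ω ⊆ᵇ s)) monomialSupports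

quadratic : Vec Bool 11 → Sub
quadratic p = monomials 𝔽₂.▸ p

anf : Sub → Vec Bool 11
anf D = moebius 𝔽₂.▸ D

IsQuadratic : Sub → Set
IsQuadratic D = quadratic (anf D) ≡ D

IsQuadratic-+ : ∀ {A B} → IsQuadratic A → IsQuadratic B → IsQuadratic (A +ₛ B)
IsQuadratic-+ {A} {B} qA qB = begin
  quadratic (anf (A +ₛ B))                     ≡⟨ cong quadratic (vec-ext (𝔽₂.▸-distrib-+ moebius A B)) ⟩
  quadratic (zipWith _xor_ (anf A) (anf B))    ≡⟨ vec-ext (𝔽₂.▸-distrib-+ monomials (anf A) (anf B)) ⟩
  quadratic (anf A) +ₛ quadratic (anf B)       ≡⟨ cong₂ _+ₛ_ qA qB ⟩
  A +ₛ B                                       ∎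
  where open ≡-Reasoning

codim2 : F2⁴ → F2⁴ → Bool → Bool → Sub
codim2 l₁ l₂ c₁ c₂ = tabulate (λ ω → foldr _ _∧_ true (zipWith (λ l c → not (dot l (bits ω) xor c)) (l₁ ∷ l₂ ∷ []) (c₁ ∷ c₂ ∷ [])))

codim2-quadratic : ∀ l₁ l₂ c₁ c₂ → IsQuadratic (codim2 l₁ l₂ c₁ c₂)
codim2-quadratic = from-yes (∀-Vec? 4 λ l₁ → ∀-Vec? 4 λ l₂ → ∀-Bool? λ c₁ → ∀-Bool? λ c₂ →
  ≡-dec Bool._≟_ (quadratic (anf (codim2 l₁ l₂ c₁ c₂))) (codim2 l₁ l₂ c₁ c₂))

RM2⇒quadratic : ∀ {D} → RM 2 D → IsQuadratic D
RM2⇒quadratic (gens , gens-codim2 , refl) = sum-quadratic gens-codim2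
  where
  sum-quadratic : ∀ {gs} → All (AffSub 2) gs → IsQuadratic (List.foldr _+ₛ_ ∅ gs)
  sum-quadratic []                                                         = refl
  sum-quadratic (((l₁ ∷ l₂ ∷ []) , (c₁ ∷ c₂ ∷ []) , _ , refl) ∷ gs-codim2) =
    IsQuadratic-+ (codim2-quadratic l₁ l₂ c₁ c₂) (sum-quadratic gs-codim2)

radicalSize : Sub → ℕ
radicalSize D = List.length (List.filter (λ u → T? (inRad D u)) (List.allFin 16))

Bent : Sub → Set
Bent D = (∀ m → ℤ.∣ walsh D m ∣ ≡ 4) × (∃ λ m → walsh D m ≡ + 4) × (∃ λ m → walsh D m ≡ ℤ.- + 4)

quadratic-bent : ∀ q → radicalSize (quadratic (false ∷ q)) ≡ 1 → Bent (quadratic (false ∷ q))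
quadratic-bent = from-yes (∀-Vec? 10 λ q → let D = quadratic (false ∷ q) in
  (radicalSize D ℕ.≟ 1) →-dec
    (∀-Vec? 4 (λ m → ℤ.∣ walsh D m ∣ ℕ.≟ 4)
     ×-dec ∃-Vec? 4 (λ m → walsh D m ℤ.≟ + 4)
     ×-dec ∃-Vec? 4 (λ m → walsh D m ℤ.≟ ℤ.- + 4)))

quadratic-ω₀ : ∀ p → lookup (quadratic p) ω₀ ≡ Vec.head p
quadratic-ω₀ (p₀ ∷ _ ∷ _ ∷ _ ∷ _ ∷ _ ∷ _ ∷ _ ∷ _ ∷ _ ∷ _ ∷ []) = xor-identityʳ p₀

defect2⇒bent : ∀ {D} → HasDefect D 2 → ω₀ ∉ₛ D → Bent D
defect2⇒bent {D} (D∈RM2 , _ , radical) ω₀∉D with anf D in anf≡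
... | false ∷ q = subst Bent D≡ (quadratic-bent q (subst (λ X → radicalSize X ≡ 1) (sym D≡) radical))
  where
  D≡ : quadratic (false ∷ q) ≡ D
  D≡ = trans (cong quadratic (sym anf≡)) (RM2⇒quadratic D∈RM2)
... | true ∷ q = contradiction ω₀∈D λ ()
  where
  ω₀∈D : false ≡ true
  ω₀∈D = begin
    false                              ≡⟨ ω₀∉D ⟨
    lookup D ω₀                        ≡⟨ cong (λ X → lookup X ω₀) (RM2⇒quadratic D∈RM2) ⟨
    lookup (quadratic (anf D)) ω₀      ≡⟨ cong (λ p → lookup (quadratic p) ω₀) anf≡ ⟩
    lookup (quadratic (true ∷ q)) ω₀   ≡⟨ quadratic-ω₀ (true ∷ q) ⟩
    true                               ∎
    where open ≡-Reasoning

dot-zero⁴ : ∀ x → dot zero⁴ x ≡ false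
dot-zero⁴ (_ ∷ _ ∷ _ ∷ _ ∷ []) = refl

walsh-zero : ∀ D → walsh D zero⁴ ≡ imbalance D
walsh-zero D = cong imbalance (+ₛ-identityʳ D)

offDiagonal : List ℤ
offDiagonal = ℤ.- + 4 ∷ + 0 ∷ + 4 ∷ []

∣z∣≡4⇒∈ : ∀ z → ℤ.∣ z ∣ ≡ 4 → z ∈ offDiagonal
∣z∣≡4⇒∈ (+ _)      refl = there (there (here refl))
∣z∣≡4⇒∈ -[1+ _ ]   refl = here refl

Admissible : Ω → Sub → Set
Admissible ω₁ D = (RM 1 D ⊎ HasDefect D 2) × ω₀ ∉ₛ D × ω₁ ∉ₛ D

admissible-imbalance : ∀ {ω₁ D} → Admissible ω₁ D → imbalance D ∈ + 16 ∷ offDiagonal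
admissible-imbalance (inj₁ D∈RM1 , ω₀∉D , _) with RM1⇒Cset D∈RM1 ω₀∉D
... | l , refl with imbalance-Cset l
...   | inj₁ refl  = here refl
...   | inj₂ balanced = there (there (here balanced))
admissible-imbalance {D = D} (inj₂ defect2 , ω₀∉D , _) =
  there (subst (_∈ offDiagonal) (walsh-zero D) (∣z∣≡4⇒∈ _ (proj₁ (defect2⇒bent defect2 ω₀∉D) zero⁴)))

admissible-walsh : ∀ {ω₁ b D} → dot b (bits ω₁) ≡ true → Admissible ω₁ D → walsh D b ∈ offDiagonal
admissible-walsh {ω₁} {b} b·ω₁ (inj₁ D∈RM1 , ω₀∉D , ω₁∉D) with RM1⇒Cset D∈RM1 ω₀∉D
... | l , refl with imbalance-Cset (l +⁴ b)
...   | inj₂ balanced = there (here (trans (cong imbalance (Cset-+ l b)) balanced))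
...   | inj₁ l+b≡0 = contradiction (begin
  false                                ≡⟨ dot-zero⁴ (bits ω₁) ⟨
  dot zero⁴ (bits ω₁)                  ≡⟨ cong (λ m → dot m (bits ω₁)) l+b≡0 ⟨
  dot (l +⁴ b) (bits ω₁)               ≡⟨ dot-+⁴ l b (bits ω₁) ⟩
  dot l (bits ω₁) xor dot b (bits ω₁)  ≡⟨ cong₂ _xor_ (trans (sym (lookup-Cset l ω₁)) ω₁∉D) b·ω₁ ⟩
  true                                 ∎) λ ()
  where open ≡-Reasoning
admissible-walsh {b = b} _ (inj₂ defect2 , ω₀∉D , _) = ∣z∣≡4⇒∈ _ (proj₁ (defect2⇒bent defect2 ω₀∉D) b)

single-linIndep : ∀ ℓ → ℓ ≡ zero⁴ ⊎ LinIndep (ℓ ∷ [])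
single-linIndep = from-yes (∀-Vec? 4 λ ℓ → (ℓ ≟⁴ zero⁴) ⊎-dec ∀-Vec? 1 λ s →
  (foldr _ (zipWith _xor_) zero⁴ (zipWith (λ c l → Vec.map (c ∧_) l) s (ℓ ∷ [])) ≟⁴ zero⁴) →-dec (≡-dec Bool._≟_ s (false ∷ [])))

Cset∈RM1 : ∀ ℓ → RM 1 (Cset ℓ)
Cset∈RM1 ℓ with single-linIndep ℓ
... | inj₁ refl  = [] , [] , refl
... | inj₂ indep = (Cset ℓ ∷ []) , (hyperplane ∷ []) , sym (+ₛ-identityʳ (Cset ℓ))
  where
  complement-twice : ∀ x → x ≡ not (x xor true) ∧ true
  complement-twice false = refl
  complement-twice true  = refl
  hyperplane : AffSub 1 (Cset ℓ)
  hyperplane = (ℓ ∷ []) , (true ∷ []) , indep , tabulate-cong (λ ω → complement-twice (dot ℓ (bits ω)))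

unique-lookup-injective : ∀ {a} {A : Set a} {xs : List A} → Unique xs → ∀ {i j} → List.lookup xs i ≡ List.lookup xs j → i ≡ j
unique-lookup-injective (_    ∷ _)   {zero}  {zero}  _  = refl
unique-lookup-injective (x∉xs ∷ _)   {zero}  {suc j} eq = contradiction eq (All.lookup x∉xs (∈-lookup j))
unique-lookup-injective (x∉xs ∷ _)   {suc i} {zero}  eq = contradiction (sym eq) (All.lookup x∉xs (∈-lookup i))
unique-lookup-injective (_    ∷ !xs) {suc i} {suc j} eq = cong suc (unique-lookup-injective !xs eq)

injective-into⇒≤ : ∀ {a} {A : Set a} {m} {ys : List A} {f : Fin m → A} →
  (∀ {i j} → f i ≡ f j → i ≡ j) → (∀ i → f i ∈ ys) → m ℕ.≤ List.length ys
injective-into⇒≤ {ys = ys} {f} f-injective f∈ys = injective⇒≤ position-injective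
  where
  position-injective : ∀ {i j} → Any.index (f∈ys i) ≡ Any.index (f∈ys j) → i ≡ j
  position-injective {i} {j} eq = f-injective (trans (lookup-index (f∈ys i)) (trans (cong (List.lookup ys) eq) (sym (lookup-index (f∈ys j)))))

record Enumeration {a} {A : Set a} (xs : List A) (m : ℕ) : Set a where
  field
    point           : Fin m → A
    point-injective : ∀ {i j} → point i ≡ point j → i ≡ j
    point∈          : ∀ i → point i ∈ xs
    index           : ∀ {x} → x ∈ xs → Fin m
    point-index     : ∀ {x} (x∈ : x ∈ xs) → point (index x∈) ≡ x

enumerate : ∀ {a} {A : Set a} (_≟_ : DecidableEquality A) (xs : List A) {m} →
  List.length (List.deduplicate _≟_ xs) ≡ m → Enumeration xs m
enumerate _≟_ xs {m} eq = record
  { point           = λ i → List.lookup ys (Fin.cast (sym eq) i)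
  ; point-injective = λ {i} {j} p → trans (sym (cast-involutive eq (sym eq) i))
                        (trans (cong (Fin.cast eq) (unique-lookup-injective (deduplicate-! _≟_ xs) p)) (cast-involutive eq (sym eq) j))
  ; point∈          = λ i → ∈-deduplicate⁻ _≟_ xs (∈-lookup (Fin.cast (sym eq) i))
  ; index           = λ x∈ → Fin.cast eq (Any.index (∈-deduplicate⁺ _≟_ x∈))
  ; point-index     = λ x∈ → trans (cong (List.lookup ys) (cast-involutive (sym eq) eq _)) (sym (lookup-index (∈-deduplicate⁺ _≟_ x∈)))
  }
  where ys = List.deduplicate _≟_ xs

all⊎any : ∀ {a p q} {A : Set a} {P : A → Set p} {Q : A → Set q} (xs : List A) →
  (∀ {x} → x ∈ xs → P x ⊎ Q x) → (∀ {x} → x ∈ xs → P x) ⊎ ∃ λ x → x ∈ xs × Q x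
all⊎any []       _   = inj₁ λ ()
all⊎any (x ∷ xs) P⊎Q with P⊎Q (here refl) | all⊎any xs (P⊎Q ∘ there)
... | inj₂ Qx | _                 = inj₂ (x , here refl , Qx)
... | inj₁ _  | inj₂ (y , y∈ , Qy) = inj₂ (y , there y∈ , Qy)
... | inj₁ Px | inj₁ allP         = inj₁ λ { (here refl) → Px ; (there y∈) → allP y∈ }

∈-tail : ∀ {a} {A : Set a} {x y : A} {xs} → x ∈ y ∷ xs → x ≢ y → x ∈ xs
∈-tail (here x≡y) x≢y = contradiction x≡y x≢y
∈-tail (there x∈) _   = x∈

-- Spherical codes of ±1-vectors

IsCosine : ℤ → ℤ → ℚ → Set
IsCosine N z c = (c ℚ.* c ℚ.* toℚ (N ℤ.* N) ≡ toℚ (z ℤ.* z)) × (0ℚ ℚ.≤ c ℚ.* toℚ z)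

isCosine? : ∀ N z c → Dec (IsCosine N z c)
isCosine? N z c = (c ℚ.* c ℚ.* toℚ (N ℤ.* N) ℚ.≟ toℚ (z ℤ.* z)) ×-dec (0ℚ ℚ.≤? c ℚ.* toℚ z)

Pointwise-∈ˡ : ∀ {a b r} {A : Set a} {B : Set b} {R : A → B → Set r} {xs ys x} →
  Pointwise R xs ys → x ∈ xs → ∃ λ y → y ∈ ys × R x y
Pointwise-∈ˡ (Rxy ∷ _)    (here refl) = _ , here refl , Rxy
Pointwise-∈ˡ (_   ∷ Rxys) (there x∈)  = let (y , y∈ , Rxy) = Pointwise-∈ˡ Rxys x∈ in y , there y∈ , Rxy

Pointwise-∈ʳ : ∀ {a b r} {A : Set a} {B : Set b} {R : A → B → Set r} {xs ys y} →
  Pointwise R xs ys → y ∈ ys → ∃ λ x → x ∈ xs × R x y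
Pointwise-∈ʳ (Rxy ∷ _)    (here refl) = _ , here refl , Rxy
Pointwise-∈ʳ (_   ∷ Rxys) (there y∈)  = let (x , x∈ , Rxy) = Pointwise-∈ʳ Rxys y∈ in x , there x∈ , Rxy

record SignCode {n} (xs : List (Vec ℤ n)) (m : ℕ) (zs : List ℤ) : Set where
  field
    point       : Fin m → Vec ℤ n
    point-sign  : ∀ i → SignVector (point i)
    point∈      : ∀ i → point i ∈ xs
    covers      : ∀ {x} → x ∈ xs → ∃ λ i → point i ≡ x
    ip∈         : ∀ {i j} → i ≢ j → ip (point i) (point j) ∈ zs
    ip-attained : ∀ {z} → z ∈ zs → ∃₂ λ i j → i ≢ j × ip (point i) (point j) ≡ z

signCode⇒codeIs : ∀ {n xs m zs cs} → SignCode {ℕ.suc n} xs m zs → + ℕ.suc n ∉ zs →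
  Pointwise (IsCosine (+ ℕ.suc n)) zs cs → CodeIs xs m cs
signCode⇒codeIs {n} {xs} {m} {zs} {cs} code n∉zs cosines = record
  { nonzero     = λ x x∈ → let (i , eq) = covers x∈ in subst (λ x → x ≢ _) eq (signVector≢0 (point-sign i))
  ; pt          = point
  ; pt∈         = point∈
  ; ptDistinct  = λ i j i≢j ray → n∉zs (subst (_∈ zs) (ip-same i j (sameRay⇒≡ (point-sign i) (point-sign j) ray)) (ip∈ i≢j))
  ; covers      = λ x x∈ → let (i , eq) = covers x∈ in i , 0 , 0 , cong (Vec.map (ℤ._*_ (+ 1))) (sym eq)
  ; cosIn       = λ i j i≢j → let (c , c∈ , cos) = Pointwise-∈ˡ cosines (ip∈ i≢j) in c , c∈ , isCos i j c cos
  ; cosAttained = λ c c∈ → let (z , z∈ , cos) = Pointwise-∈ʳ cosines c∈ ; (i , j , i≢j , eq) = ip-attained z∈ in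
                    i , j , i≢j , isCos i j c (subst (λ z → IsCosine (+ ℕ.suc n) z c) (sym eq) cos)
  }
  where
  open SignCode code
  ip-same : ∀ i j → point i ≡ point j → ip (point i) (point j) ≡ + ℕ.suc n
  ip-same i j eq = trans (cong (ip (point i)) (sym eq)) (ip-self (point-sign i))
  isCos : ∀ i j c → IsCosine (+ ℕ.suc n) (ip (point i) (point j)) c → IsCos (point i) (point j) c
  isCos i j c cos rewrite ip-self (point-sign i) | ip-self (point-sign j) = cos

removeAt-zero : ∀ {n} (v : Vec ℤ (ℕ.suc n)) → removeAt v zero ≡ Vec.tail v
removeAt-zero (_ ∷ _) = refl

dropFirst : ∀ {n xs m zs} → (code : SignCode {ℕ.suc n} xs m zs) → (∀ i → lookup (SignCode.point code i) zero ≡ + 1) →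
  SignCode (List.map (λ v → removeAt v zero) xs) m (List.map ℤ.pred zs)
dropFirst {n} {xs} {m} {zs} code first≡1 = record
  { point       = λ i → removeAt (point i) zero
  ; point-sign  = λ i → subst SignVector (sym (removeAt-zero (point i))) (tail-sign (point-sign i))
  ; point∈      = λ i → ∈-map⁺ (λ v → removeAt v zero) (point∈ i)
  ; covers      = λ x∈ → let (v , v∈ , eq) = ∈-map⁻ (λ v → removeAt v zero) x∈ ; (i , eq′) = covers v∈ in
                    i , trans (cong (λ v → removeAt v zero) eq′) (sym eq)
  ; ip∈         = λ i≢j → subst (_∈ List.map ℤ.pred zs) (sym (ip-dropFirst _ _)) (∈-map⁺ ℤ.pred (ip∈ i≢j))
  ; ip-attained = λ z∈ → let (z′ , z′∈ , eq) = ∈-map⁻ ℤ.pred z∈ ; (i , j , i≢j , eq′) = ip-attained z′∈ in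
                    i , j , i≢j , trans (ip-dropFirst i j) (trans (cong ℤ.pred eq′) (sym eq))
  }
  where
  open SignCode code
  tail-sign : ∀ {v : Vec ℤ (ℕ.suc n)} → SignVector v → SignVector (Vec.tail v)
  tail-sign (_ ∷ v±) = v±
  ip-dropFirst : ∀ i j → ip (removeAt (point i) zero) (removeAt (point j) zero) ≡ ℤ.pred (ip (point i) (point j))
  ip-dropFirst i j = lemma (point i) (point j) (first≡1 i) (first≡1 j)
    where
    lemma : ∀ (u v : Vec ℤ (ℕ.suc n)) → lookup u zero ≡ + 1 → lookup v zero ≡ + 1 → ip (removeAt u zero) (removeAt v zero) ≡ ℤ.pred (ip u v)
    lemma (_ ∷ u) (_ ∷ v) refl refl = sym (ℤ.pred-suc (ip u v))

record Factorisation (ω₁ : Ω) (b : F2⁴) (h : Mat 16) : Set where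
  field
    A     : Sub
    g     : Mat₂ 4
    A∈RM2 : RM 2 A
    ω₀∉A  : ω₀ ∉ₛ A
    ω₁∉A  : ω₁ ∉ₛ A
    g∈Q   : InQ ω₁ b g
    h≡εP  : h ≡ εM A *ₘ PM g

  g∈GL : InGL 4 g
  g∈GL = proj₁ g∈Q

  g⁻¹ : Mat₂ 4
  g⁻¹ = proj₁ g∈GL

factorise : ∀ {ω₁ b h} → InJQ ω₁ b h → Factorisation ω₁ b h
factorise (A , g , A∈RM2 , ω₀∉A , ω₁∉A , g∈Q , h≡εP) = record
  { A = A ; g = g ; A∈RM2 = A∈RM2 ; ω₀∉A = ω₀∉A ; ω₁∉A = ω₁∉A ; g∈Q = g∈Q ; h≡εP = h≡εP }

Cset-▹ : ∀ {ω₁ b g} → InQ ω₁ b g → ∀ ω → lookup (Cset b) (ω ▹ g) ≡ lookup (Cset b) ω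
Cset-▹ {b = b} {g} (g∈GL , _ , into , onto) ω = begin
  lookup (Cset b) (ω ▹ g)  ≡⟨ lookup-Cset b (ω ▹ g) ⟩
  dot b (bits (ω ▹ g))     ≡⟨ same-side ⟩
  dot b (bits ω)           ≡⟨ lookup-Cset b ω ⟨
  lookup (Cset b) ω        ∎
  where
  open ≡-Reasoning
  ∈B₀ : ∀ {η} → η ∈ₛ B₀ b → dot b (bits η) ≡ false
  ∈B₀ {η} η∈ = not-injective (trans (sym (lookup∘tabulate (λ ω → not (dot b (bits ω))) η)) η∈)
  ∈B₀⁻ : ∀ {η} → dot b (bits η) ≡ false → η ∈ₛ B₀ b
  ∈B₀⁻ {η} eq = trans (lookup∘tabulate (λ ω → not (dot b (bits ω))) η) (cong not eq)
  same-side : dot b (bits (ω ▹ g)) ≡ dot b (bits ω)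
  same-side with dot b (bits ω) in bω | dot b (bits (ω ▹ g)) in bωg
  ... | false | false = refl
  ... | true  | true  = refl
  ... | false | true  = contradiction (trans (sym bωg) (∈B₀ {ω ▹ g} (into ω (∈B₀⁻ {ω} bω)))) λ ()
  ... | true  | false = let (η , η∈B₀ , ηg≡ωg) = onto (ω ▹ g) (∈B₀⁻ {ω ▹ g} bωg) in
                        contradiction (trans (sym bω) (∈B₀ {ω} (subst (_∈ₛ B₀ b) (▹-injective g∈GL {η} {ω} ηg≡ωg) η∈B₀))) λ ()

module FactorisationProperties {ω₁ b h} (F : Factorisation ω₁ b h) where
  open Factorisation F

  lookup-⋆h : ∀ x ω → lookup (x ⋆ h) (ω ▹ g) ≡ lookup x ω ℤ.* sgn (lookup A ω)
  lookup-⋆h x ω = trans (cong (λ h → lookup (x ⋆ h) (ω ▹ g)) h≡εP) (lookup-⋆-signedPermutation g∈GL x A ω)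

  ip-⋆h : ∀ u v → ip (u ⋆ h) (v ⋆ h) ≡ ip u v
  ip-⋆h u v = trans (cong (λ h → ip (u ⋆ h) (v ⋆ h)) h≡εP) (ip-⋆-signedPermutation g∈GL A u v)

  εC-⋆h : ∀ u → (u ⋆ εM (Cset b)) ⋆ h ≡ (u ⋆ h) ⋆ εM (Cset b)
  εC-⋆h u = vec-ext-▹ g∈GL λ ω → begin
    lookup ((u ⋆ εM C) ⋆ h) (ω ▹ g)                        ≡⟨ lookup-⋆h (u ⋆ εM C) ω ⟩
    lookup (u ⋆ εM C) ω ℤ.* sgn (lookup A ω)               ≡⟨ cong (ℤ._* sgn (lookup A ω)) (lookup-⋆-εM u C ω) ⟩
    lookup u ω ℤ.* sgn (lookup C ω) ℤ.* sgn (lookup A ω)   ≡⟨ swap (lookup u ω) (sgn (lookup C ω)) (sgn (lookup A ω)) ⟩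
    lookup u ω ℤ.* sgn (lookup A ω) ℤ.* sgn (lookup C ω)   ≡⟨ cong₂ ℤ._*_ (lookup-⋆h u ω) (cong sgn (Cset-▹ {b = b} g∈Q ω)) ⟨
    lookup (u ⋆ h) (ω ▹ g) ℤ.* sgn (lookup C (ω ▹ g))      ≡⟨ lookup-⋆-εM (u ⋆ h) C (ω ▹ g) ⟨
    lookup ((u ⋆ h) ⋆ εM C) (ω ▹ g)                        ∎
    where
    open ≡-Reasoning
    C = Cset b
    swap : ∀ x s t → x ℤ.* s ℤ.* t ≡ x ℤ.* t ℤ.* s
    swap = solve-∀

  x₀⋆h-sign : SignVector (x₀ ⋆ h)
  x₀⋆h-sign = subst SignVector (sym (trans (cong (x₀ ⋆_) h≡εP) (⋆-∙ x₀ (εM A) (PM g))))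
    (signVector-⋆-PM g∈GL (signVector-⋆-εM A signVector-x₀))

  lookup-x₀⋆h : ∀ ω → lookup (x₀ ⋆ h) (ω ▹ g) ≡ sgn (lookup A ω)
  lookup-x₀⋆h ω = trans (cong (λ h → lookup (x₀ ⋆ h) (ω ▹ g)) h≡εP) (lookup-x₀⋆signedPermutation g∈GL A ω)

  x₀⋆h-ω₀ : lookup (x₀ ⋆ h) ω₀ ≡ + 1
  x₀⋆h-ω₀ = trans (cong (lookup (x₀ ⋆ h)) (sym (ω₀-▹ g))) (trans (lookup-x₀⋆h ω₀) (cong sgn ω₀∉A))

  ip-x₀⋆h-x₀ : ip (x₀ ⋆ h) x₀ ≡ imbalance A
  ip-x₀⋆h-x₀ = trans (cong (λ h → ip (x₀ ⋆ h) x₀) h≡εP) (ip-x₀⋆signedPermutation-x₀ g∈GL A)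

  Cset-pullback : ∀ m ω → lookup (Cset (g⁻¹ 𝔽₂.▸ m)) (ω ▹ g) ≡ lookup (Cset m) ω
  Cset-pullback m ω = begin
    lookup (Cset (g⁻¹ 𝔽₂.▸ m)) (ω ▹ g)   ≡⟨ lookup-Cset (g⁻¹ 𝔽₂.▸ m) (ω ▹ g) ⟩
    dot (g⁻¹ 𝔽₂.▸ m) (bits (ω ▹ g))      ≡⟨ dot-▹ (g⁻¹ 𝔽₂.▸ m) ω g ⟩
    dot (g 𝔽₂.▸ g⁻¹ 𝔽₂.▸ m) (bits ω)     ≡⟨ cong (λ l → dot l (bits ω)) (▸-▸-inverse (proj₂ g∈GL) m) ⟩
    dot m (bits ω)                        ≡⟨ lookup-Cset m ω ⟨
    lookup (Cset m) ω                     ∎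
    where open ≡-Reasoning

  ip-x₀⋆h-Cset : ∀ m → ip (x₀ ⋆ h) (x₀ ⋆ εM (Cset (g⁻¹ 𝔽₂.▸ m))) ≡ walsh A m
  ip-x₀⋆h-Cset m = trans (cong (λ h → ip (x₀ ⋆ h) (x₀ ⋆ εM (Cset (g⁻¹ 𝔽₂.▸ m)))) h≡εP) (ip-x₀⋆signedPermutation g∈GL A {Cset (g⁻¹ 𝔽₂.▸ m)} {Cset m} (Cset-pullback m))

  ip-x₀⋆h-εC : ip ((x₀ ⋆ h) ⋆ εM (Cset b)) x₀ ≡ walsh A b
  ip-x₀⋆h-εC = begin
    ip ((x₀ ⋆ h) ⋆ εM (Cset b)) x₀    ≡⟨ ip-⋆-εM-swap (Cset b) (x₀ ⋆ h) x₀ ⟩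
    ip (x₀ ⋆ h) (x₀ ⋆ εM (Cset b))    ≡⟨ cong (λ h → ip (x₀ ⋆ h) (x₀ ⋆ εM (Cset b))) h≡εP ⟩
    ip (x₀ ⋆ (εM A *ₘ PM g)) (x₀ ⋆ εM (Cset b)) ≡⟨ ip-x₀⋆signedPermutation g∈GL A {Cset b} {Cset b} (Cset-▹ {b = b} g∈Q) ⟩
    walsh A b                         ∎
    where open ≡-Reasoning

  x₀⋆h-linear : ∀ {l} → A ≡ Cset l → x₀ ⋆ h ≡ x₀ ⋆ εM (Cset (g⁻¹ 𝔽₂.▸ l))
  x₀⋆h-linear {l} A≡ = vec-ext-▹ g∈GL λ ω → begin
    lookup (x₀ ⋆ h) (ω ▹ g)                        ≡⟨ lookup-x₀⋆h ω ⟩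
    sgn (lookup A ω)                               ≡⟨ cong (λ X → sgn (lookup X ω)) A≡ ⟩
    sgn (lookup (Cset l) ω)                        ≡⟨ cong sgn (Cset-pullback l ω) ⟨
    sgn (lookup (Cset (g⁻¹ 𝔽₂.▸ l)) (ω ▹ g))       ≡⟨ lookup-x₀⋆εM (Cset (g⁻¹ 𝔽₂.▸ l)) (ω ▹ g) ⟨
    lookup (x₀ ⋆ εM (Cset (g⁻¹ 𝔽₂.▸ l))) (ω ▹ g)   ∎
    where open ≡-Reasoning

-- The code x₀H ∪ x₀Hε_C

module OrbitCode {ω₁ b} (b·ω₁ : dot b (bits ω₁) ≡ true) {H : List (Mat 16)} (H∈𝒢 : In𝒢 ω₁ b H)
  (affine-or-bent : ∀ h → h ∈ H → (A : Sub) (g : Mat₂ 4) → RM 2 A → InQ ω₁ b g →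
                    h ≡ εM A *ₘ PM g → RM 1 A ⊎ HasDefect A 2)
  (hcard : card (List.map (x₀ ⋆_) H) ≡ 64)
  where

  C : Sub
  C = Cset b

  factor : ∀ {h} → h ∈ H → Factorisation ω₁ b h
  factor h∈ = factorise (proj₁ (proj₂ (proj₂ H∈𝒢)) _ h∈)

  admissible : ∀ {h} (h∈ : h ∈ H) → Admissible ω₁ (Factorisation.A (factor h∈))
  admissible h∈ = affine-or-bent _ h∈ A g A∈RM2 g∈Q h≡εP , ω₀∉A , ω₁∉A
    where open Factorisation (factor h∈)

  AffineFactorisation BentFactorisation : Mat 16 → Set
  AffineFactorisation h = Σ (Factorisation ω₁ b h) λ F → RM 1 (Factorisation.A F)
  BentFactorisation h = Σ (Factorisation ω₁ b h) λ F → HasDefect (Factorisation.A F) 2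

  quotient : ∀ {h k} → h ∈ H → k ∈ H → ∃ λ m → m ∈ H ×
    ip (x₀ ⋆ h) (x₀ ⋆ k) ≡ ip (x₀ ⋆ m) x₀ × ip ((x₀ ⋆ h) ⋆ εM C) (x₀ ⋆ k) ≡ ip ((x₀ ⋆ m) ⋆ εM C) x₀
  quotient {h} {k} h∈ k∈ = divide (proj₂ (proj₂ (proj₁ H∈𝒢)) k k∈)
    where
    divide : (∃ λ k′ → k′ ∈ H × k *ₘ k′ ≡ Iₘ 16) → ∃ λ m → m ∈ H ×
      ip (x₀ ⋆ h) (x₀ ⋆ k) ≡ ip (x₀ ⋆ m) x₀ × ip ((x₀ ⋆ h) ⋆ εM C) (x₀ ⋆ k) ≡ ip ((x₀ ⋆ m) ⋆ εM C) x₀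
    divide (k′ , k′∈ , kk′≡I) = h *ₘ k′ , proj₁ (proj₂ (proj₁ H∈𝒢)) h k′ h∈ k′∈ , same , twisted
      where
      open FactorisationProperties (factor k′∈)
      open ≡-Reasoning
      x₀⋆k⋆k′ : (x₀ ⋆ k) ⋆ k′ ≡ x₀
      x₀⋆k⋆k′ = begin
        (x₀ ⋆ k) ⋆ k′     ≡⟨ ⋆-∙ x₀ k k′ ⟨
        x₀ ⋆ (k *ₘ k′)    ≡⟨ cong (x₀ ⋆_) kk′≡I ⟩
        x₀ ⋆ Iₘ 16        ≡⟨ ⋆-identityʳ x₀ ⟩
        x₀                ∎
      same : ip (x₀ ⋆ h) (x₀ ⋆ k) ≡ ip (x₀ ⋆ (h *ₘ k′)) x₀
      same = begin
        ip (x₀ ⋆ h) (x₀ ⋆ k)                 ≡⟨ ip-⋆h (x₀ ⋆ h) (x₀ ⋆ k) ⟨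
        ip ((x₀ ⋆ h) ⋆ k′) ((x₀ ⋆ k) ⋆ k′)   ≡⟨ cong₂ ip (sym (⋆-∙ x₀ h k′)) x₀⋆k⋆k′ ⟩
        ip (x₀ ⋆ (h *ₘ k′)) x₀               ∎
      twisted : ip ((x₀ ⋆ h) ⋆ εM C) (x₀ ⋆ k) ≡ ip ((x₀ ⋆ (h *ₘ k′)) ⋆ εM C) x₀
      twisted = begin
        ip ((x₀ ⋆ h) ⋆ εM C) (x₀ ⋆ k)                 ≡⟨ ip-⋆h ((x₀ ⋆ h) ⋆ εM C) (x₀ ⋆ k) ⟨
        ip (((x₀ ⋆ h) ⋆ εM C) ⋆ k′) ((x₀ ⋆ k) ⋆ k′)   ≡⟨ cong (λ v → ip v ((x₀ ⋆ k) ⋆ k′)) (εC-⋆h (x₀ ⋆ h)) ⟩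
        ip (((x₀ ⋆ h) ⋆ k′) ⋆ εM C) ((x₀ ⋆ k) ⋆ k′)   ≡⟨ cong₂ (λ u v → ip (u ⋆ εM C) v) (sym (⋆-∙ x₀ h k′)) x₀⋆k⋆k′ ⟩
        ip ((x₀ ⋆ (h *ₘ k′)) ⋆ εM C) x₀               ∎

  ip-orbit : ∀ {h k} → h ∈ H → k ∈ H → ip (x₀ ⋆ h) (x₀ ⋆ k) ∈ + 16 ∷ offDiagonal
  ip-orbit h∈ k∈ = let (m , m∈ , same , _) = quotient h∈ k∈ in
    subst (_∈ + 16 ∷ offDiagonal) (sym (trans same (FactorisationProperties.ip-x₀⋆h-x₀ (factor m∈))))
      (admissible-imbalance {ω₁} (admissible m∈))

  ip-orbit-εC : ∀ {h k} → h ∈ H → k ∈ H → ip ((x₀ ⋆ h) ⋆ εM C) (x₀ ⋆ k) ∈ offDiagonal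
  ip-orbit-εC h∈ k∈ = let (m , m∈ , _ , twisted) = quotient h∈ k∈ in
    subst (_∈ offDiagonal) (sym (trans twisted (FactorisationProperties.ip-x₀⋆h-εC (factor m∈))))
      (admissible-walsh {ω₁} {b} b·ω₁ (admissible m∈))

  εCset∈H : ∀ {ℓ} → dot ℓ (bits ω₁) ≡ false → εM (Cset ℓ) ∈ H
  εCset∈H {ℓ} ℓ·ω₁ = proj₁ (proj₂ H∈𝒢) (εM (Cset ℓ))
    (Cset ℓ , Cset∈RM1 ℓ , trans (lookup-Cset ℓ ω₀) (dot-ω₀ ℓ) , trans (lookup-Cset ℓ ω₁) ℓ·ω₁ , refl)

  open Enumeration (enumerate (≡-dec ℤ._≟_) (List.map (x₀ ⋆_) H) hcard)

  indexOf : ∀ {h} → h ∈ H → Fin 64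
  indexOf h∈ = index (∈-map⁺ (x₀ ⋆_) h∈)

  point-indexOf : ∀ {h} (h∈ : h ∈ H) → point (indexOf h∈) ≡ x₀ ⋆ h
  point-indexOf h∈ = point-index (∈-map⁺ (x₀ ⋆_) h∈)

  linearSigns : List (Vec ℤ 16)
  linearSigns = List.map (λ l → x₀ ⋆ εM (Cset l)) (List.map bits (List.allFin 16))

  linearSign∈ : ∀ l → x₀ ⋆ εM (Cset l) ∈ linearSigns
  linearSign∈ l = ∈-map⁺ (λ l → x₀ ⋆ εM (Cset l)) (subst (_∈ List.map bits (List.allFin 16)) (bits-fromBits l) (∈-map⁺ bits (∈-allFin (fromBits l))))

  -- If every element were affine, each x₀h would be one of the 16 vectors x₀ε_{C_ℓ}.
  bentElement : ∃ λ h → h ∈ H × BentFactorisation h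
  bentElement with all⊎any {P = AffineFactorisation} {Q = BentFactorisation} H (λ h∈ → Sum.map (factor h∈ ,_) (factor h∈ ,_) (proj₁ (admissible h∈)))
  ... | inj₂ found      = found
  ... | inj₁ all-affine = contradiction (injective-into⇒≤ point-injective point-linear) (from-no (64 ℕ.≤? 16))
    where
    point-linear : ∀ a → point a ∈ linearSigns
    point-linear a =
      let (h , h∈ , pa≡) = ∈-map⁻ (x₀ ⋆_) (point∈ a)
          (F , A∈RM1)    = all-affine h∈
          (l , A≡)       = RM1⇒Cset A∈RM1 (Factorisation.ω₀∉A F)
      in subst (_∈ linearSigns) (sym (trans pa≡ (FactorisationProperties.x₀⋆h-linear F {l} A≡))) (linearSign∈ (Factorisation.g⁻¹ F 𝔽₂.▸ l))

  pointε : Fin 64 → Vec ℤ 16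
  pointε a = point a ⋆ εM C

  codePoint : Fin 128 → Vec ℤ 16
  codePoint i = [ point , pointε ]′ (splitAt 64 i)

  codePoint-↑ˡ : ∀ a → codePoint (a ↑ˡ 64) ≡ point a
  codePoint-↑ˡ a = cong [ point , pointε ]′ (splitAt-↑ˡ 64 a 64)

  codePoint-↑ʳ : ∀ a → codePoint (64 ↑ʳ a) ≡ pointε a
  codePoint-↑ʳ a = cong [ point , pointε ]′ (splitAt-↑ʳ 64 64 a)

  ↑ˡ≢↑ʳ : ∀ a a′ → a ↑ˡ 64 ≢ 64 ↑ʳ a′
  ↑ˡ≢↑ʳ a a′ eq with trans (sym (splitAt-↑ˡ 64 a 64)) (trans (cong (splitAt 64) eq) (splitAt-↑ʳ 64 64 a′))
  ... | ()

  point-orbit : ∀ a → ∃ λ h → Σ (h ∈ H) λ h∈ → point a ≡ x₀ ⋆ h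
  point-orbit a = ∈-map⁻ (x₀ ⋆_) (point∈ a)

  point-sign : ∀ a → SignVector (point a)
  point-sign a = let (h , h∈ , pa≡) = point-orbit a in
    subst SignVector (sym pa≡) (FactorisationProperties.x₀⋆h-sign (factor h∈))

  codePoint-sign : ∀ i → SignVector (codePoint i)
  codePoint-sign i = side-sign (splitAt 64 i)
    where
    side-sign : ∀ s → SignVector ([ point , pointε ]′ s)
    side-sign (inj₁ a) = point-sign a
    side-sign (inj₂ a) = signVector-⋆-εM C (point-sign a)

  ip-points : ∀ a a′ → a ≢ a′ → ip (point a) (point a′) ∈ offDiagonal
  ip-points a a′ a≢a′ =
    let (h , h∈ , pa≡) = point-orbit a ; (h′ , h′∈ , pa′≡) = point-orbit a′ in
    ∈-tail (subst (_∈ + 16 ∷ offDiagonal) (sym (cong₂ ip pa≡ pa′≡)) (ip-orbit h∈ h′∈))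
           (λ ip≡16 → a≢a′ (point-injective (ip≡n⇒≡ (point-sign a) (point-sign a′) ip≡16)))

  ip-pointsε : ∀ a a′ → ip (pointε a) (point a′) ∈ offDiagonal
  ip-pointsε a a′ =
    let (h , h∈ , pa≡) = point-orbit a ; (h′ , h′∈ , pa′≡) = point-orbit a′ in
    subst (_∈ offDiagonal) (sym (cong₂ ip (cong (_⋆ εM C) pa≡) pa′≡)) (ip-orbit-εC h∈ h′∈)

  ip-split : ∀ s t → s ≢ t → ip ([ point , pointε ]′ s) ([ point , pointε ]′ t) ∈ offDiagonal
  ip-split (inj₁ a) (inj₁ a′) s≢t = ip-points a a′ (s≢t ∘ cong inj₁)
  ip-split (inj₂ a) (inj₂ a′) s≢t = subst (_∈ offDiagonal) (sym (ip-⋆-εM C (point a) (point a′))) (ip-points a a′ (s≢t ∘ cong inj₂))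
  ip-split (inj₂ a) (inj₁ a′) _   = ip-pointsε a a′
  ip-split (inj₁ a) (inj₂ a′) _   = subst (_∈ offDiagonal) (ℤᴸ.inner-comm (pointε a′) (point a)) (ip-pointsε a′ a)

  ip∈ : ∀ {i j} → i ≢ j → ip (codePoint i) (codePoint j) ∈ offDiagonal
  ip∈ {i} {j} i≢j = ip-split (splitAt 64 i) (splitAt 64 j) λ eq →
    i≢j (trans (sym (join-splitAt 64 64 i)) (trans (cong (Fin.join 64 64) eq) (join-splitAt 64 64 j)))

  distinct-by-ip : ∀ {i j z} → ip (codePoint i) (codePoint j) ≡ z → z ≢ + 16 → ∃₂ λ i j → i ≢ j × ip (codePoint i) (codePoint j) ≡ z
  distinct-by-ip {i} {j} {z} ip≡z z≢16 = i , j , i≢j , ip≡z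
    where
    i≢j : i ≢ j
    i≢j i≡j = z≢16 (begin
      z                                ≡⟨ ip≡z ⟨
      ip (codePoint i) (codePoint j)   ≡⟨ cong (λ k → ip (codePoint i) (codePoint k)) i≡j ⟨
      ip (codePoint i) (codePoint i)   ≡⟨ ip-self (codePoint-sign i) ⟩
      + 16                             ∎)
      where open ≡-Reasoning

  linearPoint : ∀ ℓ → ∃ λ i → codePoint i ≡ x₀ ⋆ εM (Cset ℓ)
  linearPoint ℓ = by-side (dot ℓ (bits ω₁)) refl
    where
    by-side : ∀ β → dot ℓ (bits ω₁) ≡ β → ∃ λ i → codePoint i ≡ x₀ ⋆ εM (Cset ℓ)
    by-side false ℓ·ω₁ = indexOf (εCset∈H {ℓ} ℓ·ω₁) ↑ˡ 64 , trans (codePoint-↑ˡ (indexOf (εCset∈H {ℓ} ℓ·ω₁))) (point-indexOf (εCset∈H {ℓ} ℓ·ω₁))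
    by-side true ℓ·ω₁ = 64 ↑ʳ indexOf (εCset∈H {ℓ +⁴ b} ℓ+b·ω₁) , (begin
      codePoint (64 ↑ʳ indexOf (εCset∈H {ℓ +⁴ b} ℓ+b·ω₁))   ≡⟨ codePoint-↑ʳ (indexOf (εCset∈H {ℓ +⁴ b} ℓ+b·ω₁)) ⟩
      point (indexOf (εCset∈H {ℓ +⁴ b} ℓ+b·ω₁)) ⋆ εM C      ≡⟨ cong (_⋆ εM C) (point-indexOf (εCset∈H {ℓ +⁴ b} ℓ+b·ω₁)) ⟩
      (x₀ ⋆ εM (Cset (ℓ +⁴ b))) ⋆ εM (Cset b)      ≡⟨ ⋆-εM-εM x₀ (Cset (ℓ +⁴ b)) (Cset b) ⟩
      x₀ ⋆ εM (Cset (ℓ +⁴ b) +ₛ Cset b)            ≡⟨ cong (λ X → x₀ ⋆ εM X) (trans (Cset-+ (ℓ +⁴ b) b) (cong Cset (+⁴-cancelʳ ℓ b))) ⟩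
      x₀ ⋆ εM (Cset ℓ)                             ∎)
      where
      open ≡-Reasoning
      ℓ+b·ω₁ : dot (ℓ +⁴ b) (bits ω₁) ≡ false
      ℓ+b·ω₁ = trans (dot-+⁴ ℓ b (bits ω₁)) (cong₂ _xor_ ℓ·ω₁ b·ω₁)

  balanced-attained : ∃₂ λ i j → i ≢ j × ip (codePoint i) (codePoint j) ≡ + 0
  balanced-attained = a ↑ˡ 64 , 64 ↑ʳ a , ↑ˡ≢↑ʳ a a , (begin
    ip (codePoint (a ↑ˡ 64)) (codePoint (64 ↑ʳ a)) ≡⟨ cong₂ ip (codePoint-↑ˡ a) (codePoint-↑ʳ a) ⟩
    ip (point a) (point a ⋆ εM C)                  ≡⟨ cong (λ v → ip v (v ⋆ εM C)) (trans (point-indexOf I∈H) (⋆-identityʳ x₀)) ⟩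
    ip x₀ (x₀ ⋆ εM C)                              ≡⟨ ip-x₀-x₀⋆εM C ⟩
    imbalance C                                    ≡⟨ Cset-balanced ⟩
    + 0                                            ∎)
    where
    open ≡-Reasoning
    I∈H = proj₁ (proj₁ H∈𝒢)
    a = indexOf I∈H
    Cset-balanced : imbalance C ≡ + 0
    Cset-balanced = [ (λ b≡0 → contradiction (trans (sym b·ω₁) (trans (cong (λ l → dot l (bits ω₁)) b≡0) (dot-zero⁴ (bits ω₁)))) λ ())
                    , (λ balanced → balanced) ]′ (imbalance-Cset b)

  walsh-attained : ∀ {z} → z ≢ + 16 → (∀ {A} → Bent A → ∃ λ m → walsh A m ≡ z) → ∃₂ λ i j → i ≢ j × ip (codePoint i) (codePoint j) ≡ z
  walsh-attained {z} z≢16 witness =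
    let (h , h∈ , F , defect2) = bentElement
        (m , walsh≡z)          = witness {Factorisation.A F} (defect2⇒bent defect2 (Factorisation.ω₀∉A F))
        (j , cpj≡)             = linearPoint (Factorisation.g⁻¹ F 𝔽₂.▸ m)
        open ≡-Reasoning
    in distinct-by-ip {indexOf h∈ ↑ˡ 64} {j} (begin
    ip (codePoint (indexOf h∈ ↑ˡ 64)) (codePoint j)                     ≡⟨ cong₂ ip (trans (codePoint-↑ˡ (indexOf h∈)) (point-indexOf h∈)) cpj≡ ⟩
    ip (x₀ ⋆ h) (x₀ ⋆ εM (Cset (Factorisation.g⁻¹ F 𝔽₂.▸ m)))           ≡⟨ FactorisationProperties.ip-x₀⋆h-Cset F m ⟩
    walsh (Factorisation.A F) m                                         ≡⟨ walsh≡z ⟩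
    z                                                                   ∎) z≢16

  ip-attained : ∀ {z} → z ∈ offDiagonal → ∃₂ λ i j → i ≢ j × ip (codePoint i) (codePoint j) ≡ z
  ip-attained (here refl)                 = walsh-attained (λ ()) (proj₂ ∘ proj₂)
  ip-attained (there (here refl))         = balanced-attained
  ip-attained (there (there (here refl))) = walsh-attained (λ ()) (proj₁ ∘ proj₂)

  G : List (Mat 16)
  G = H ++ List.map (λ h → h *ₘ εM C) H

  codePoint∈ : ∀ i → codePoint i ∈ List.map (x₀ ⋆_) G
  codePoint∈ i = side∈ (splitAt 64 i)
    where
    side∈ : ∀ s → [ point , pointε ]′ s ∈ List.map (x₀ ⋆_) G
    side∈ (inj₁ a) = let (h , h∈ , pa≡) = point-orbit a in
      subst (_∈ List.map (x₀ ⋆_) G) (sym pa≡) (∈-map⁺ (x₀ ⋆_) (∈-++⁺ˡ h∈))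
    side∈ (inj₂ a) = let (h , h∈ , pa≡) = point-orbit a in
      subst (_∈ List.map (x₀ ⋆_) G) (trans (⋆-∙ x₀ h (εM C)) (cong (_⋆ εM C) (sym pa≡)))
        (∈-map⁺ (x₀ ⋆_) (∈-++⁺ʳ H (∈-map⁺ (λ h → h *ₘ εM C) h∈)))

  covers : ∀ {x} → x ∈ List.map (x₀ ⋆_) G → ∃ λ i → codePoint i ≡ x
  covers x∈ = let (h , h∈G , x≡) = ∈-map⁻ (x₀ ⋆_) x∈ in by-half h∈G x≡
    where
    by-half : ∀ {x h} → h ∈ G → x ≡ x₀ ⋆ h → ∃ λ i → codePoint i ≡ x
    by-half {x} {h} h∈G x≡ with ∈-++⁻ H h∈G
    ... | inj₁ h∈ = indexOf h∈ ↑ˡ 64 , trans (codePoint-↑ˡ (indexOf h∈)) (trans (point-indexOf h∈) (sym x≡))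
    ... | inj₂ h∈εH = let (k , k∈ , h≡) = ∈-map⁻ (λ h → h *ₘ εM C) h∈εH in
      64 ↑ʳ indexOf k∈ , trans (codePoint-↑ʳ (indexOf k∈)) (trans (cong (_⋆ εM C) (point-indexOf k∈))
        (trans (sym (⋆-∙ x₀ k (εM C))) (trans (cong (x₀ ⋆_) (sym h≡)) (sym x≡))))

  codePoint-ω₀ : ∀ i → lookup (codePoint i) zero ≡ + 1
  codePoint-ω₀ i = side-ω₀ (splitAt 64 i)
    where
    point-ω₀ : ∀ a → lookup (point a) ω₀ ≡ + 1
    point-ω₀ a = let (h , h∈ , pa≡) = point-orbit a in
      trans (cong (λ v → lookup v ω₀) pa≡) (FactorisationProperties.x₀⋆h-ω₀ (factor h∈))
    side-ω₀ : ∀ s → lookup ([ point , pointε ]′ s) ω₀ ≡ + 1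
    side-ω₀ (inj₁ a) = point-ω₀ a
    side-ω₀ (inj₂ a) = trans (lookup-⋆-εM (point a) C ω₀)
      (cong₂ ℤ._*_ (point-ω₀ a) (cong sgn (trans (lookup-Cset b ω₀) (dot-ω₀ b))))

  code : SignCode (List.map (x₀ ⋆_) G) 128 offDiagonal
  code = record
    { point       = codePoint
    ; point-sign  = codePoint-sign
    ; point∈      = codePoint∈
    ; covers      = covers
    ; ip∈         = ip∈
    ; ip-attained = ip-attained
    }

theorem4p13 : (ω₁ : Ω) (b : F2⁴) → dot b (bits ω₁) ≡ true →
  (H : List (Mat 16)) → In𝒢 ω₁ b H →
  (∀ h → h ∈ H → (A : Sub) (g : Mat₂ 4) → RM 2 A → InQ ω₁ b g →
     h ≡ εM A *ₘ PM g → RM 1 A ⊎ HasDefect A 2) →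
  card (map (x₀ ⋆_) H) ≡ 64 →
  CodeIs (map (x₀ ⋆_) (H ++ map (λ h → h *ₘ εM (Cset b)) H)) 128
      (- (+ 1 / 4) ∷ 0ℚ ∷ (+ 1 / 4) ∷ [])
  × CodeIs (map (λ h → removeAt (x₀ ⋆ h) ω₀) (H ++ map (λ h → h *ₘ εM (Cset b)) H)) 128
      (- (+ 1 / 3) ∷ - (+ 1 / 15) ∷ (+ 1 / 5) ∷ [])
theorem4p13 ω₁ b b·ω₁ H H∈𝒢 affine-or-bent hcard =
  signCode⇒codeIs code (from-no (+ 16 ∈? offDiagonal))
    (from-yes (Pointwise.decidable (isCosine? (+ 16)) offDiagonal (- (+ 1 / 4) ∷ 0ℚ ∷ (+ 1 / 4) ∷ []))) ,
  subst (λ xs → CodeIs xs 128 (- (+ 1 / 3) ∷ - (+ 1 / 15) ∷ (+ 1 / 5) ∷ []))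
    -- ω₀ computes to the index zero
    (sym (map-∘ {g = λ v → removeAt v zero} {f = x₀ ⋆_} G))
    (signCode⇒codeIs (dropFirst code codePoint-ω₀) (from-no (+ 15 ∈? List.map ℤ.pred offDiagonal))
      (from-yes (Pointwise.decidable (isCosine? (+ 15)) (List.map ℤ.pred offDiagonal) (- (+ 1 / 3) ∷ - (+ 1 / 15) ∷ (+ 1 / 5) ∷ []))))
  where open OrbitCode {ω₁} {b} b·ω₁ {H} H∈𝒢 affine-or-bent hcard
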